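{- Let $\Delta_1$ be a $(k+1)$-bit matchgate which is reducible: its bottom input node $k+1$ and its bottom output node (the output node of index $n-(k+1)+1$, where $n$ is the number of nodes) are joined by an edge of weight $1$, and no other edge is incident to either of these two nodes. Let $\Gamma_1$ be the $k$-bit matchgate obtained from $\Delta_1$ by deleting this edge together with these two nodes. Then: (i) if $\chi(\Delta_1)$ is nonsingular, so is $\chi(\Gamma_1)$; (ii) if $\chi(\Gamma_1)^{ -1}$ exists and is a character matrix (of a $k$-bit matchgate), then $\chi(\Delta_1)^{ -1}$ is a character matrix (of a $(k+1)$-bit matchgate).
   Context: A $k$-bit matchgate $\Gamma=(G,X,Y,T)$ is a weighted graph $G$ on nodes $\{1,\dots,n\}$ with input nodes $X=\{1,\dots,k\}$, output nodes $Y=\{n-k+1,\dots,n\}$ and a disjoint set $T$ of omittable nodes; each node of $X\cup Y$ carries an external edge to a vertex of index smaller (inputs) or larger (outputs) than all of $\{1,\dots,n\}$. For $Z\subseteq X\cup Y$, $\chi(\Gamma,Z)=\mu(\Gamma,Z)\,\mathrm{PfS}(G-Z)$, where $\mathrm{PfS}(G-Z)=\sum_{A\subseteq T}\mathrm{Pf}(M[A])$ with $M$ the skew-symmetric adjacency matrix of $G-Z$ ($M(i,j)=w(i,j)$ for $i<j$, $-w(i,j)$ for $i>j$) and $M[A]$ its restriction deleting indices in $A$, and $\mu(\Gamma,Z)\in\{\pm1\}$ is the parity of the number of overlaps between matched edges in $G-Z$ and the external edges of the nodes of $Z$ (edges $(a,b),(c,d)$, $a<b,c<d$, overlap iff $a<c<b<d$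 or $c<a<d<b$). The character matrix $\chi(\Gamma)$ is the $2^k\times2^k$ matrix with entry in row $i_1\cdots i_k$ and column $i_ni_{n-1}\cdots i_{n-k+1}$ equal to $\chi(\Gamma,\{j\in X\cup Y: i_j=1\})$. A matrix is a character matrix if it is $\chi(\Gamma)$ for some matchgate $\Gamma$. -}

module Defs where

open import Level using (_⊔_)
open import Algebra.Bundles using (CommutativeRing)
open import Data.Bool using (Bool; true; false; not; _∧_; _∨_; if_then_else_)
open import Data.Nat as ℕ using (ℕ; zero; suc; _+_; _<ᵇ_)
open import Data.Fin as Fin using (Fin; toℕ; splitAt; opposite; _↑ˡ_; _↑ʳ_; inject₁; fromℕ)
open import Data.Vec as Vec using (Vec; []; _∷_; lookup)
open import Data.List as List using (List; []; _∷_; _++_; map; concatMap; filterᵇ; allFin; length; foldr)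
open import Data.Product using (_×_; _,_; Σ; ∃)
open import Data.Sum using (_⊎_; inj₁; inj₂)
open import Relation.Binary.PropositionalEquality using (_≡_)
open import Relation.Nullary using (¬_)

bits : (k : ℕ) → List (Vec Bool k)
bits zero    = [] ∷ []
bits (suc k) = map (false ∷_) (bits k) ++ map (true ∷_) (bits k)

eqBool : Bool → Bool → Bool
eqBool true  b = b
eqBool false b = not b

eqBits : ∀ {k} → Vec Bool k → Vec Bool k → Bool
eqBits []       []       = true
eqBits (x ∷ xs) (y ∷ ys) = eqBool x y ∧ eqBits xs ys

picks : ∀ {A : Set} {n} → Vec A (suc n) → List (A × Vec A n)
picks {n = zero}  (x ∷ [])  = (x , []) ∷ []
picks {n = suc n} (x ∷ xs) =
  (x , xs) ∷ map (λ p → Data.Product.proj₁ p , x ∷ Data.Product.proj₂ p) (picks xs)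

-- all perfect matchings of an (increasingly sorted) list of vertices;
-- each matched edge is listed as (a , b) with a before b in the list
perfectMatchings : ∀ {A : Set} n → Vec A n → List (List (A × A))
perfectMatchings zero          []       = [] ∷ []
perfectMatchings (suc zero)    _        = []
perfectMatchings (suc (suc n)) (x ∷ xs) =
  concatMap (λ p → map ((x , Data.Product.proj₁ p) ∷_)
                       (perfectMatchings n (Data.Product.proj₂ p)))
            (picks xs)

overlaps : ℕ × ℕ → ℕ × ℕ → Bool
overlaps (a , b) (c , d) =
  ((a <ᵇ c) ∧ (c <ᵇ b) ∧ (b <ᵇ d)) ∨ ((c <ᵇ a) ∧ (a <ᵇ d) ∧ (d <ᵇ b))

allᵇ : ∀ {A : Set} → (A → Bool) → List A → Bool
allᵇ p = foldr (λ x b → p x ∧ b) true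

count : ∀ {A : Set} → (A → Bool) → List A → ℕ
count p xs = length (filterᵇ p xs)

rankEdge : ∀ {n} → Fin n × Fin n → ℕ × ℕ
rankEdge (i , j) = toℕ i , toℕ j

-- number of (unordered) overlapping pairs among the edges of a matching
-- (each unordered overlapping pair {e,f} is counted once, namely as the
--  ordered pair with the smaller left endpoint first)
crossings : ∀ {n} → List (Fin n × Fin n) → ℕ
crossings P = count (λ ef → oneWay (rankEdge (Data.Product.proj₁ ef)) (rankEdge (Data.Product.proj₂ ef)))
                    (concatMap (λ e → map (e ,_) P) P)
  where
  oneWay : ℕ × ℕ → ℕ × ℕ → Bool
  oneWay (a , b) (c , d) = (a <ᵇ c) ∧ (c <ᵇ b) ∧ (b <ᵇ d)

-- Node classification for a k-bit matchgate on n = k + m + k nodes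
-- (0-based: inputs 0..k-1, then m further nodes, outputs k+m..k+m+k-1)

isInput : ∀ {k m} → Fin (k + m + k) → Bool
isInput {k} {m} i with splitAt (k + m) i
... | inj₂ _  = false
... | inj₁ i′ with splitAt k i′
...   | inj₁ _ = true
...   | inj₂ _ = false

onMiddle : ∀ {k m} → (Fin m → Bool) → Fin (k + m + k) → Bool
onMiddle {k} {m} P i with splitAt (k + m) i
... | inj₂ _  = false
... | inj₁ i′ with splitAt k i′
...   | inj₁ _ = false
...   | inj₂ t = P t

-- the set Z ⊆ X ∪ Y encoded by row index r = i_1…i_k and
-- column index c = i_n i_{n-1} … i_{n-k+1}
inZ : ∀ {k m} → Vec Bool k → Vec Bool k → Fin (k + m + k) → Bool
inZ {k} {m} r c i with splitAt (k + m) i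
... | inj₂ t  = lookup c (opposite t)
... | inj₁ i′ with splitAt k i′
...   | inj₁ j = lookup r j
...   | inj₂ _ = false

module _ {a ℓ} (R : CommutativeRing a ℓ) where
  open CommutativeRing R renaming (Carrier to K; _+_ to _+ᴿ_; _*_ to _*ᴿ_)

  ΣL : ∀ {A : Set} → List A → (A → K) → K
  ΣL xs f = foldr (λ x s → f x +ᴿ s) 0# xs

  ΠL : ∀ {A : Set} → List A → (A → K) → K
  ΠL xs f = foldr (λ x s → f x *ᴿ s) 1# xs

  sgn : ℕ → K
  sgn zero    = 1#
  sgn (suc n) = - sgn n

  -- A k-bit matchgate: n = k + m + k nodes, inputs X = first k nodes,
  -- outputs Y = last k nodes, omittable nodes T ⊆ the m remaining nodes.
  -- weight i j (for toℕ i < toℕ j) is the weight of the edge {i,j};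
  -- weight 0 means there is no edge.
  record Matchgate (k : ℕ) : Set a where
    field
      m         : ℕ
      weight    : Fin (k + m + k) → Fin (k + m + k) → K
      omittable : Fin m → Bool
  open Matchgate public

  skewAdj : ∀ {n} → (Fin n → Fin n → K) → Fin n → Fin n → K
  skewAdj w i j =
    if toℕ i <ᵇ toℕ j then w i j
    else if toℕ j <ᵇ toℕ i then - w j i
    else 0#

  -- Pfaffian of the principal submatrix of M on the (sorted) index list L:
  -- Pf = Σ over perfect matchings P of (-1)^{#crossings P} ∏_{(i,j)∈P} M(i,j)
  PfTerm : ∀ {n} → (Fin n → Fin n → K) → List (Fin n × Fin n) → K
  PfTerm M P = sgn (crossings P) *ᴿ ΠL P (λ e → M (Data.Product.proj₁ e) (Data.Product.proj₂ e))

  module _ {k : ℕ} (Γ : Matchgate k) where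
    private
      n = k + m Γ + k

    keptNodes : Vec Bool k → Vec Bool k → Vec Bool (m Γ) → List (Fin n)
    keptNodes r c A =
      filterᵇ (λ i → not (inZ {k} {m Γ} r c i ∨ onMiddle {k} {m Γ} (lookup A) i)) (allFin n)

    subsetsOfT : List (Vec Bool (m Γ))
    subsetsOfT = filterᵇ (λ A → allᵇ (λ t → not (lookup A t) ∨ omittable Γ t) (allFin (m Γ))) (bits (m Γ))

    -- external edge of a node z ∈ X ∪ Y, in ranks where node i has rank
    -- toℕ i + 1, the outside input vertex rank 0, outside output vertex n + 1
    extEdge : Fin n → ℕ × ℕ
    extEdge z = if isInput {k} {m Γ} z then (0 , suc (toℕ z)) else (suc (toℕ z) , suc n)

    μ : Vec Bool k → Vec Bool k → List (Fin n × Fin n) → K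
    μ r c P = sgn (count (λ ze → overlaps (extEdge (Data.Product.proj₁ ze))
                                           (suc (toℕ (Data.Product.proj₁ (Data.Product.proj₂ ze))) ,
                                            suc (toℕ (Data.Product.proj₂ (Data.Product.proj₂ ze)))))
                         (concatMap (λ z → map (z ,_) P)
                                    (filterᵇ (inZ {k} {m Γ} r c) (allFin n))))

    -- χ(Γ,Z) = μ(Γ,Z) PfS(G - Z) = Σ_{A ⊆ T} Σ_{P} μ(P) (-1)^{cr P} ∏ M(e)
    χ : Vec Bool k → Vec Bool k → K
    χ r c = ΣL subsetsOfT (λ A →
              let L = keptNodes r c A in
              ΣL (perfectMatchings (length L) (Vec.fromList L)) (λ P →
                μ r c P *ᴿ PfTerm (skewAdj (weight Γ)) P))

  Mat : ℕ → Set a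
  Mat k = Vec Bool k → Vec Bool k → K

  _⊗_ : ∀ {k} → Mat k → Mat k → Mat k
  _⊗_ {k} A B r c = ΣL (bits k) (λ s → A r s *ᴿ B s c)

  idMat : ∀ {k} → Mat k
  idMat r c = if eqBits r c then 1# else 0#

  _≈M_ : ∀ {k} → Mat k → Mat k → Set ℓ
  A ≈M B = ∀ r c → A r c ≈ B r c

  IsInverse : ∀ {k} → Mat k → Mat k → Set ℓ
  IsInverse A B = ((A ⊗ B) ≈M idMat) × ((B ⊗ A) ≈M idMat)

  Nonsingular : ∀ {k} → Mat k → Set (a ⊔ ℓ)
  Nonsingular A = ∃ λ B → IsInverse A B

  charMat : ∀ {k} → Matchgate k → Mat k
  charMat Γ = χ Γ

  IsCharacterMatrix : ∀ {k} → Mat k → Set (a ⊔ ℓ)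
  IsCharacterMatrix {k} A = ∃ λ (Γ : Matchgate k) → charMat Γ ≈M A

  -- bottom input node (node k+1, 1-based) and bottom output node
  -- (node n-(k+1)+1, 1-based) of a (k+1)-bit matchgate
  botIn : ∀ {k m} → Fin (suc k + m + suc k)
  botIn {k} {m} = (fromℕ k ↑ˡ m) ↑ˡ suc k

  botOut : ∀ {k m} → Fin (suc k + m + suc k)
  botOut {k} {m} = (suc k + m) ↑ʳ Fin.zero

  Reducible : ∀ {k} → Matchgate (suc k) → Set ℓ
  Reducible {k} Δ =
    (weight Δ (botIn {k} {m Δ}) (botOut {k} {m Δ}) ≈ 1#) ×
    (∀ i j → toℕ i ℕ.< toℕ j →
       (i ≡ botIn {k} {m Δ} ⊎ j ≡ botIn {k} {m Δ} ⊎ i ≡ botOut {k} {m Δ} ⊎ j ≡ botOut {k} {m Δ}) →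
       ¬ (i ≡ botIn {k} {m Δ} × j ≡ botOut {k} {m Δ}) →
       weight Δ i j ≈ 0#)

  -- order-preserving embedding of the nodes of Γ₁ into those of Δ₁,
  -- skipping botIn and botOut
  embedNode : ∀ {k m} → Fin (k + m + k) → Fin (suc k + m + suc k)
  embedNode {k} {m} i with splitAt (k + m) i
  ... | inj₂ t  = (suc k + m) ↑ʳ Fin.suc t
  ... | inj₁ i′ with splitAt k i′
  ...   | inj₁ j = (inject₁ j ↑ˡ m) ↑ˡ suc k
  ...   | inj₂ t = (suc k ↑ʳ t) ↑ˡ suc k

  deleteBottom : ∀ {k} → Matchgate (suc k) → Matchgate k
  deleteBottom {k} Δ = record
    { m         = m Δ
    ; weight    = λ i j → weight Δ (embedNode {k} {m Δ} i) (embedNode {k} {m Δ} j)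
    ; omittable = omittable Δ
    }

module Submission where

-- Let y and z be the bottom input and bottom output node of Δ₁, and Γ₁ the
-- matchgate without them.  Index rows and columns of χ(Δ₁) as r ∷ʳ b and
-- c ∷ʳ b′, where b, b′ record whether y, z belong to Z.  The heart of the
-- proof is the identity (`reduction`)
--
--   χ(Δ₁)(r ∷ʳ b , c ∷ʳ b′) = [b = b′] · s(r) s(c) · χ(Γ₁)(r , c),
--
-- with s(r) = (-1)^(number of zeros of r); that is, χ(Δ₁) = Lift χ(Γ₁) for
-- the block-diagonal, sign-twisted embedding Lift of 2^k×2^k matrices into
-- 2^(k+1)×2^(k+1) matrices.  It is proved term by term in the Pfaffian
-- sums: if y, z ∈ Z the remaining graphs coincide up to relabelling; if
-- y, z ∉ Z every matching of nonzero weight contains the edge {y,z}, and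
-- removing it gives a matching of Γ₁; if exactly one of them is in Z, the
-- other one is isolated and the sum vanishes.  The relative signs are
-- parity computations on the positions of nodes.
--
-- Both parts of the theorem are then short
-- matrix computations.

open import Defs
open import Algebra.Bundles using (CommutativeRing)
open import Data.Bool using (Bool; true; false; not; _∧_; _∨_; if_then_else_; T)
open import Data.Nat using (ℕ; zero; suc; _+_; _<_; _≤_; _<ᵇ_; z≤n; s≤s)
import Data.Nat.Properties as ℕP
import Data.Bool.Properties as BoolP
open import Data.Nat.Tactic.RingSolver using (solve-∀)
open import Data.Fin as Fin using (Fin; toℕ; splitAt; opposite; _↑ˡ_; _↑ʳ_; inject₁; fromℕ; join)
import Data.Fin.Properties as FinP
open import Data.Maybe as Maybe using (Maybe; just; nothing)
open import Data.Product using (_×_; ∃; _,_; proj₁; proj₂)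
open import Data.Sum using (_⊎_; inj₁; inj₂)
open import Data.Empty using (⊥; ⊥-elim)
open import Data.Unit using (tt)
open import Data.List using (List; []; _∷_; _++_; map; concatMap; foldr; length; tabulate; allFin; filterᵇ)
import Data.List.Properties as ListP
open import Data.List.Relation.Unary.All as All using (All; []; _∷_)
import Data.List.Relation.Unary.All.Properties as AllP
open import Data.List.Relation.Unary.AllPairs using (AllPairs; []; _∷_)
import Data.List.Relation.Unary.AllPairs.Properties as AllPairsP
open import Data.Vec as Vec using (Vec; lookup; _∷ʳ_; init; last)
import Data.Vec.Properties as VecP
open import Relation.Binary.PropositionalEquality as ≡ using (_≡_; _≢_)
open import Relation.Nullary using (¬_; yes; no; does)
open import Relation.Nullary.Decidable using (T?; dec-true)
import Algebra.Properties.Ring as RingProperties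
import Algebra.Solver.CommutativeMonoid as CMSolver
import Relation.Binary.Reasoning.Setoid as SetoidReasoning

ind : Bool → ℕ
ind true  = 1
ind false = 0

<ᵇ-true : ∀ {x y} → x < y → (x <ᵇ y) ≡ true
<ᵇ-true {x} {y} x<y with x <ᵇ y in eq
... | true  = ≡.refl
... | false = ⊥-elim (≡.subst T eq (ℕP.<⇒<ᵇ x<y))

<ᵇ-false : ∀ {x y} → y ≤ x → (x <ᵇ y) ≡ false
<ᵇ-false {x} {y} y≤x with x <ᵇ y in eq
... | false = ≡.refl
... | true  = ⊥-elim (ℕP.<⇒≱ (ℕP.<ᵇ⇒< x y (≡.subst T (≡.sym eq) tt)) y≤x)

<ᵇ-irrefl : ∀ n → (n <ᵇ n) ≡ false
<ᵇ-irrefl n = <ᵇ-false {n} {n} ℕP.≤-refl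

<ᵇ-transport : ∀ {x y x′ y′} → (x < y → x′ < y′) → (y ≤ x → y′ ≤ x′) → (x <ᵇ y) ≡ (x′ <ᵇ y′)
<ᵇ-transport {x} {y} f g with ℕP.<-≤-connex x y
... | inj₁ x<y = ≡.trans (<ᵇ-true x<y) (≡.sym (<ᵇ-true (f x<y)))
... | inj₂ y≤x = ≡.trans (<ᵇ-false y≤x) (≡.sym (<ᵇ-false (g y≤x)))

toℕ<ᵇn : ∀ {n} (x : Fin n) → (toℕ x <ᵇ n) ≡ true
toℕ<ᵇn x = <ᵇ-true (FinP.toℕ<n x)

n<ᵇtoℕ : ∀ {n} (x : Fin n) → (n <ᵇ toℕ x) ≡ false
n<ᵇtoℕ x = <ᵇ-false (ℕP.<⇒≤ (FinP.toℕ<n x))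

sumN : ∀ {A : Set} → List A → (A → ℕ) → ℕ
sumN xs f = foldr (λ x s → f x + s) 0 xs

module _ {A : Set} where

  sumN-++ : (xs ys : List A) (f : A → ℕ) → sumN (xs ++ ys) f ≡ sumN xs f + sumN ys f
  sumN-++ []       ys f = ≡.refl
  sumN-++ (x ∷ xs) ys f = ≡.trans (≡.cong (f x +_) (sumN-++ xs ys f)) (≡.sym (ℕP.+-assoc (f x) _ _))

  sumN-cong : (xs : List A) {f g : A → ℕ} → (∀ x → f x ≡ g x) → sumN xs f ≡ sumN xs g
  sumN-cong []       h = ≡.refl
  sumN-cong (x ∷ xs) h = ≡.cong₂ _+_ (h x) (sumN-cong xs h)

  sumN-congAll : {xs : List A} {f g : A → ℕ} → All (λ x → f x ≡ g x) xs → sumN xs f ≡ sumN xs g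
  sumN-congAll []       = ≡.refl
  sumN-congAll (h ∷ hs) = ≡.cong₂ _+_ h (sumN-congAll hs)

  sumN-+ : (xs : List A) (f g : A → ℕ) → sumN xs (λ x → f x + g x) ≡ sumN xs f + sumN xs g
  sumN-+ []       f g = ≡.refl
  sumN-+ (x ∷ xs) f g = ≡.trans (≡.cong ((f x + g x) +_) (sumN-+ xs f g)) (interchange (f x) (g x) _ _)
    where
    interchange : ∀ a b c d → (a + b) + (c + d) ≡ (a + c) + (b + d)
    interchange = solve-∀

  sumN-swap : (Q : List A) (e f : A) (Ps : List A) (g : A → ℕ) →
              sumN (Q ++ e ∷ f ∷ Ps) g ≡ sumN (Q ++ f ∷ e ∷ Ps) g
  sumN-swap []      e f Ps g = swap (g e) (g f) (sumN Ps g)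
    where
    swap : ∀ a b c → a + (b + c) ≡ b + (a + c)
    swap = solve-∀
  sumN-swap (q ∷ Q) e f Ps g = ≡.cong (g q +_) (sumN-swap Q e f Ps g)

  count-sumN : (p : A → Bool) (xs : List A) → count p xs ≡ sumN xs (λ x → ind (p x))
  count-sumN p []       = ≡.refl
  count-sumN p (x ∷ xs) with p x
  ... | true  = ≡.cong suc (count-sumN p xs)
  ... | false = count-sumN p xs

  sumN-filter : (p : A → Bool) (xs : List A) (f : A → ℕ) →
                sumN (filterᵇ p xs) f ≡ sumN xs (λ x → if p x then f x else 0)
  sumN-filter p []       f = ≡.refl
  sumN-filter p (x ∷ xs) f with p x
  ... | true  = ≡.cong (f x +_) (sumN-filter p xs f)
  ... | false = sumN-filter p xs f

  -- A sum of even numbers is even; this is how all sign comparisons end.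
  sumN-even : (F : A → ℕ) (xs : List A) → All (λ x → ∃ λ h → F x ≡ h + h) xs → ∃ λ H → sumN xs F ≡ H + H
  sumN-even F []       []             = 0 , ≡.refl
  sumN-even F (x ∷ xs) ((h , e) ∷ hs) with sumN-even F xs hs
  ... | H , e′ = h + H , ≡.trans (≡.cong₂ _+_ e e′) (regroup h H)
    where
    regroup : ∀ a b → (a + a) + (b + b) ≡ (a + b) + (a + b)
    regroup = solve-∀

module _ {A B : Set} where

  sumN-map : (g : A → B) (xs : List A) (f : B → ℕ) → sumN (map g xs) f ≡ sumN xs (λ x → f (g x))
  sumN-map g []       f = ≡.refl
  sumN-map g (x ∷ xs) f = ≡.cong (f (g x) +_) (sumN-map g xs f)

  sumN-concatMap : (h : A → List B) (xs : List A) (f : B → ℕ) →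
                   sumN (concatMap h xs) f ≡ sumN xs (λ x → sumN (h x) f)
  sumN-concatMap h []       f = ≡.refl
  sumN-concatMap h (x ∷ xs) f =
    ≡.trans (sumN-++ (h x) (concatMap h xs) f) (≡.cong (sumN (h x) f +_) (sumN-concatMap h xs f))

module _ {A B : Set} where

  count-pairs : (p : A × B → Bool) (xs : List A) (ys : List B) →
                count p (concatMap (λ x → map (x ,_) ys) xs) ≡ sumN xs (λ x → sumN ys (λ y → ind (p (x , y))))
  count-pairs p xs ys =
    ≡.trans (count-sumN p (concatMap (λ x → map (x ,_) ys) xs))
      (≡.trans (sumN-concatMap (λ x → map (x ,_) ys) xs (λ q → ind (p q)))
        (sumN-cong xs (λ x → sumN-map (x ,_) ys (λ q → ind (p q)))))

sumN-tabulate : ∀ {A : Set} {n} (f : Fin n → A) (h : A → ℕ) → sumN (tabulate f) h ≡ sumN (allFin n) (λ i → h (f i))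
sumN-tabulate {n = n} f h =
  ≡.trans (≡.cong (λ L → sumN L h) (≡.sym (ListP.map-tabulate (λ i → i) f))) (sumN-map f (allFin n) h)

module _ {A : Set} where

  consIf : Bool → A → List A → List A
  consIf true  x xs = x ∷ xs
  consIf false x xs = xs

  filterᵇ-∷ : (p : A → Bool) (x : A) (xs : List A) → filterᵇ p (x ∷ xs) ≡ consIf (p x) x (filterᵇ p xs)
  filterᵇ-∷ p x xs with p x
  ... | true  = ≡.refl
  ... | false = ≡.refl

  filterᵇ-++ : (p : A → Bool) (xs ys : List A) → filterᵇ p (xs ++ ys) ≡ filterᵇ p xs ++ filterᵇ p ys
  filterᵇ-++ p = ListP.filter-++ (λ x → T? (p x))

  filterᵇ-cong : {p q : A → Bool} (xs : List A) → (∀ x → p x ≡ q x) → filterᵇ p xs ≡ filterᵇ q xs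
  filterᵇ-cong []       h = ≡.refl
  filterᵇ-cong {p} {q} (x ∷ xs) h with p x | q x | h x
  ... | true  | true  | _ = ≡.cong (x ∷_) (filterᵇ-cong xs h)
  ... | false | false | _ = filterᵇ-cong xs h

  filterᵇ-sound : (p : A → Bool) (xs : List A) → All (λ x → p x ≡ true) (filterᵇ p xs)
  filterᵇ-sound p []       = []
  filterᵇ-sound p (x ∷ xs) with p x in eq
  ... | true  = eq ∷ filterᵇ-sound p xs
  ... | false = filterᵇ-sound p xs

  tabulate-+ : ∀ a b (f : Fin (a + b) → A) → tabulate f ≡ tabulate (λ i → f (i ↑ˡ b)) ++ tabulate (λ i → f (a ↑ʳ i))
  tabulate-+ zero    b f = ≡.refl
  tabulate-+ (suc a) b f = ≡.cong (f Fin.zero ∷_) (tabulate-+ a b (λ i → f (Fin.suc i)))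

  tabulate-last : ∀ n (f : Fin (suc n) → A) → tabulate f ≡ tabulate (λ i → f (inject₁ i)) ++ f (fromℕ n) ∷ []
  tabulate-last zero    f = ≡.refl
  tabulate-last (suc n) f = ≡.cong (f Fin.zero ∷_) (tabulate-last n (λ i → f (Fin.suc i)))

module _ {A B : Set} where

  filterᵇ-map : (p : B → Bool) (f : A → B) (xs : List A) → filterᵇ p (map f xs) ≡ map f (filterᵇ (λ x → p (f x)) xs)
  filterᵇ-map p f []       = ≡.refl
  filterᵇ-map p f (x ∷ xs) with p (f x)
  ... | true  = ≡.cong (f x ∷_) (filterᵇ-map p f xs)
  ... | false = filterᵇ-map p f xs

sumN-opposite : ∀ n (g : Fin n → ℕ) → sumN (allFin n) (λ t → g (opposite t)) ≡ sumN (allFin n) g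
sumN-opposite zero    g = ≡.refl
sumN-opposite (suc n) g = begin
  g (fromℕ n) + sumN (tabulate Fin.suc) (λ t → g (opposite t))
    ≡⟨ ≡.cong (g (fromℕ n) +_) (≡.trans (sumN-tabulate Fin.suc (λ t → g (opposite t))) (sumN-opposite n (λ i → g (inject₁ i)))) ⟩
  g (fromℕ n) + sumN (allFin n) (λ i → g (inject₁ i))
    ≡⟨ ℕP.+-comm (g (fromℕ n)) _ ⟩
  sumN (allFin n) (λ i → g (inject₁ i)) + g (fromℕ n)
    ≡⟨ ≡.cong₂ _+_ (≡.sym (sumN-tabulate inject₁ g)) (≡.sym (ℕP.+-identityʳ (g (fromℕ n)))) ⟩
  sumN (tabulate inject₁) g + sumN (fromℕ n ∷ []) g
    ≡⟨ ≡.sym (sumN-++ (tabulate inject₁) (fromℕ n ∷ []) g) ⟩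
  sumN (tabulate inject₁ ++ fromℕ n ∷ []) g
    ≡⟨ ≡.cong (λ L → sumN L g) (≡.sym (tabulate-last n (λ i → i))) ⟩
  sumN (allFin (suc n)) g ∎
  where open ≡.≡-Reasoning

lookup-∷ʳ-inject₁ : ∀ {A : Set} {n} (xs : Vec A n) x (i : Fin n) → lookup (xs ∷ʳ x) (inject₁ i) ≡ lookup xs i
lookup-∷ʳ-inject₁ (y Vec.∷ xs) x Fin.zero    = ≡.refl
lookup-∷ʳ-inject₁ (y Vec.∷ xs) x (Fin.suc i) = lookup-∷ʳ-inject₁ xs x i

lookup-∷ʳ-last : ∀ {A : Set} {n} (xs : Vec A n) x → lookup (xs ∷ʳ x) (fromℕ n) ≡ x
lookup-∷ʳ-last Vec.[]       x = ≡.refl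
lookup-∷ʳ-last (y Vec.∷ xs) x = lookup-∷ʳ-last xs x

-- `perfectMatchings` from the definitions works on vectors; we reason with
-- the same recursion on lists, where the vertex list can be split freely.

module _ {A : Set} where

  choices : List A → List (A × List A)
  choices []       = []
  choices (x ∷ xs) = (x , xs) ∷ map (λ p → proj₁ p , x ∷ proj₂ p) (choices xs)

  matchings : ℕ → List A → List (List (A × A))
  matchings zero          []       = [] ∷ []
  matchings zero          (_ ∷ _)  = []
  matchings (suc zero)    _        = []
  matchings (suc (suc n)) []       = []
  matchings (suc (suc n)) (x ∷ xs) =
    concatMap (λ p → map ((x , proj₁ p) ∷_) (matchings n (proj₂ p))) (choices xs)

  private
    toListChoice : ∀ {m} → A × Vec A m → A × List A
    toListChoice p = proj₁ p , Vec.toList (proj₂ p)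

  picks≡choices : ∀ {n} (v : Vec A (suc n)) → map toListChoice (picks v) ≡ choices (Vec.toList v)
  picks≡choices {zero}  (x Vec.∷ Vec.[]) = ≡.refl
  picks≡choices {suc n} (x Vec.∷ xs) = ≡.cong ((x , Vec.toList xs) ∷_) (begin
      map toListChoice (map (λ p → proj₁ p , x Vec.∷ proj₂ p) (picks xs))
        ≡⟨ ≡.sym (ListP.map-∘ (picks xs)) ⟩
      map (λ p → proj₁ p , x ∷ Vec.toList (proj₂ p)) (picks xs)
        ≡⟨ ListP.map-∘ (picks xs) ⟩
      map (λ p → proj₁ p , x ∷ proj₂ p) (map toListChoice (picks xs))
        ≡⟨ ≡.cong (map _) (picks≡choices xs) ⟩
      map (λ p → proj₁ p , x ∷ proj₂ p) (choices (Vec.toList xs)) ∎)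
    where open ≡.≡-Reasoning

  perfectMatchings≡matchings : ∀ n (v : Vec A n) → perfectMatchings n v ≡ matchings n (Vec.toList v)
  perfectMatchings≡matchings zero          Vec.[]       = ≡.refl
  perfectMatchings≡matchings (suc zero)    v            = ≡.refl
  perfectMatchings≡matchings (suc (suc n)) (x Vec.∷ xs) = begin
      concatMap (λ p → map ((x , proj₁ p) ∷_) (perfectMatchings n (proj₂ p))) (picks xs)
        ≡⟨ ListP.concatMap-cong (λ p → ≡.cong (map ((x , proj₁ p) ∷_)) (perfectMatchings≡matchings n (proj₂ p))) (picks xs) ⟩
      concatMap (λ p → map ((x , proj₁ p) ∷_) (matchings n (Vec.toList (proj₂ p)))) (picks xs)
        ≡⟨ ≡.sym (ListP.concatMap-map _ toListChoice (picks xs)) ⟩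
      concatMap (λ p → map ((x , proj₁ p) ∷_) (matchings n (proj₂ p))) (map toListChoice (picks xs))
        ≡⟨ ≡.cong (concatMap _) (picks≡choices xs) ⟩
      concatMap (λ p → map ((x , proj₁ p) ∷_) (matchings n (proj₂ p))) (choices (Vec.toList xs)) ∎
    where open ≡.≡-Reasoning

  perfectMatchings-fromList : (L : List A) → perfectMatchings (length L) (Vec.fromList L) ≡ matchings (length L) L
  perfectMatchings-fromList L =
    ≡.trans (perfectMatchings≡matchings (length L) (Vec.fromList L)) (≡.cong (matchings (length L)) (VecP.toList∘fromList L))

  matchings-0 : ∀ (xs : List A) y ys → matchings 0 (xs ++ y ∷ ys) ≡ []
  matchings-0 []       y ys = ≡.refl
  matchings-0 (x ∷ xs) y ys = ≡.refl

  choices-All : ∀ {Q : A → Set} {xs} → All Q xs → All (λ p → Q (proj₁ p) × All Q (proj₂ p)) (choices xs)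
  choices-All []         = []
  choices-All (qx ∷ qxs) = (qx , qxs) ∷ AllP.map⁺ (All.map (λ { (a , b) → a , qx ∷ b }) (choices-All qxs))

  choices-AllPairs : ∀ {R : A → A → Set} {xs} → AllPairs R xs → All (λ p → AllPairs R (proj₂ p)) (choices xs)
  choices-AllPairs []         = []
  choices-AllPairs (rx ∷ rxs) =
    rxs ∷ AllP.map⁺ (All.zipWith (λ { (a , b) → proj₂ a ∷ b }) (choices-All rx , choices-AllPairs rxs))

  choices-sumN : ∀ (f : A → ℕ) xs → All (λ p → f (proj₁ p) + sumN (proj₂ p) f ≡ sumN xs f) (choices xs)
  choices-sumN f []       = []
  choices-sumN f (x ∷ xs) =
    ≡.refl ∷ AllP.map⁺ (All.map (λ {p} e → ≡.trans (swap (f (proj₁ p)) (f x) _) (≡.cong (f x +_) e)) (choices-sumN f xs))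
    where
    swap : ∀ a b c → a + (b + c) ≡ b + (a + c)
    swap = solve-∀

  -- What a matching P of a list L sorted by R satisfies: every edge is
  -- R-ordered, and since P covers each vertex of L exactly once, summing a
  -- vertex weight f over the endpoints of P gives the total of f over L.
  CoversSorted : (A → A → Set) → (A → ℕ) → List A → List (A × A) → Set
  CoversSorted R f L Ps = All (λ e → R (proj₁ e) (proj₂ e)) Ps × sumN Ps (λ e → f (proj₁ e) + f (proj₂ e)) ≡ sumN L f

  matchings-cover : ∀ {R : A → A → Set} (f : A → ℕ) n L → AllPairs R L → All (CoversSorted R f L) (matchings n L)
  matchings-cover f zero          []       _          = ([] , ≡.refl) ∷ []
  matchings-cover f zero          (x ∷ L)  _          = []
  matchings-cover f (suc zero)    L        _          = []
  matchings-cover f (suc (suc n)) []       _          = []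
  matchings-cover f (suc (suc n)) (x ∷ xs) (rx ∷ rxs) =
    AllP.concat⁺ (AllP.map⁺ (All.zipWith extend (choices-All rx , All.zip (choices-AllPairs rxs , choices-sumN f xs))))
    where
    extend : ∀ {p} → (_ × All _ (proj₂ p)) × (AllPairs _ (proj₂ p) × (f (proj₁ p) + sumN (proj₂ p) f ≡ sumN xs f)) →
             All (CoversSorted _ f (x ∷ xs)) (map ((x , proj₁ p) ∷_) (matchings n (proj₂ p)))
    extend {p} ((rxp , _) , (sorted , total)) =
      AllP.map⁺ (All.map (λ { (ordered , sums) → (rxp ∷ ordered) ,
                                ≡.trans (ℕP.+-assoc (f x) _ _) (≡.cong (f x +_) (≡.trans (≡.cong (f (proj₁ p) +_) sums) total)) })
                         (matchings-cover f n (proj₂ p) sorted))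

module _ {A B : Set} (h : A → B) where

  mapEdge : A × A → B × B
  mapEdge e = h (proj₁ e) , h (proj₂ e)

  choices-map : ∀ xs → choices (map h xs) ≡ map (λ p → h (proj₁ p) , map h (proj₂ p)) (choices xs)
  choices-map []       = ≡.refl
  choices-map (x ∷ xs) = ≡.cong ((h x , map h xs) ∷_) (begin
      map (λ p → proj₁ p , h x ∷ proj₂ p) (choices (map h xs))
        ≡⟨ ≡.cong (map _) (choices-map xs) ⟩
      map (λ p → proj₁ p , h x ∷ proj₂ p) (map (λ p → h (proj₁ p) , map h (proj₂ p)) (choices xs))
        ≡⟨ ≡.sym (ListP.map-∘ (choices xs)) ⟩
      map (λ p → h (proj₁ p) , h x ∷ map h (proj₂ p)) (choices xs)
        ≡⟨ ListP.map-∘ (choices xs) ⟩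
      map (λ p → h (proj₁ p) , map h (proj₂ p)) (map (λ p → proj₁ p , x ∷ proj₂ p) (choices xs)) ∎)
    where open ≡.≡-Reasoning

  matchings-map : ∀ n xs → matchings n (map h xs) ≡ map (map mapEdge) (matchings n xs)
  matchings-map zero          []       = ≡.refl
  matchings-map zero          (x ∷ xs) = ≡.refl
  matchings-map (suc zero)    xs       = ≡.refl
  matchings-map (suc (suc n)) []       = ≡.refl
  matchings-map (suc (suc n)) (x ∷ xs) = begin
      concatMap (λ p → map ((h x , proj₁ p) ∷_) (matchings n (proj₂ p))) (choices (map h xs))
        ≡⟨ ≡.cong (concatMap _) (choices-map xs) ⟩
      concatMap (λ p → map ((h x , proj₁ p) ∷_) (matchings n (proj₂ p))) (map _ (choices xs))
        ≡⟨ ListP.concatMap-map _ _ (choices xs) ⟩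
      concatMap (λ p → map ((h x , h (proj₁ p)) ∷_) (matchings n (map h (proj₂ p)))) (choices xs)
        ≡⟨ ListP.concatMap-cong (λ p → ≡.trans (≡.cong (map _) (matchings-map n (proj₂ p)))
              (≡.trans (≡.sym (ListP.map-∘ (matchings n (proj₂ p)))) (ListP.map-∘ (matchings n (proj₂ p))))) (choices xs) ⟩
      concatMap (λ p → map (map mapEdge) (map ((x , proj₁ p) ∷_) (matchings n (proj₂ p)))) (choices xs)
        ≡⟨ ≡.sym (ListP.map-concatMap _ _ (choices xs)) ⟩
      map (map mapEdge) (concatMap (λ p → map ((x , proj₁ p) ∷_) (matchings n (proj₂ p))) (choices xs)) ∎
    where open ≡.≡-Reasoning

module RingSums {c ℓ} (R : CommutativeRing c ℓ) where
  open CommutativeRing R hiding (zero) renaming (Carrier to K; _+_ to _+ᴿ_; _*_ to _*ᴿ_)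
  open RingProperties ring using (-‿distribˡ-*; -‿distribʳ-*; -‿involutive)
  open SetoidReasoning setoid

  ∑ : ∀ {A : Set} → List A → (A → K) → K
  ∑ = ΣL R

  ∏ : ∀ {A : Set} → List A → (A → K) → K
  ∏ = ΠL R

  ∑-cong : ∀ {A : Set} (xs : List A) {f g : A → K} → (∀ x → f x ≈ g x) → ∑ xs f ≈ ∑ xs g
  ∑-cong []       h = refl
  ∑-cong (x ∷ xs) h = +-cong (h x) (∑-cong xs h)

  ∑-congAll : ∀ {A : Set} {xs : List A} {f g : A → K} → All (λ x → f x ≈ g x) xs → ∑ xs f ≈ ∑ xs g
  ∑-congAll []       = refl
  ∑-congAll (h ∷ hs) = +-cong h (∑-congAll hs)

  ∑-++ : ∀ {A : Set} (xs ys : List A) (f : A → K) → ∑ (xs ++ ys) f ≈ ∑ xs f +ᴿ ∑ ys f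
  ∑-++ []       ys f = sym (+-identityˡ _)
  ∑-++ (x ∷ xs) ys f = trans (+-congˡ (∑-++ xs ys f)) (sym (+-assoc _ _ _))

  ∑-map : ∀ {A B : Set} (g : A → B) (xs : List A) (f : B → K) → ∑ (map g xs) f ≡ ∑ xs (λ x → f (g x))
  ∑-map g []       f = ≡.refl
  ∑-map g (x ∷ xs) f = ≡.cong (f (g x) +ᴿ_) (∑-map g xs f)

  ∑-concatMap : ∀ {A B : Set} (h : A → List B) (xs : List A) (f : B → K) →
                 ∑ (concatMap h xs) f ≈ ∑ xs (λ x → ∑ (h x) f)
  ∑-concatMap h []       f = refl
  ∑-concatMap h (x ∷ xs) f = trans (∑-++ (h x) (concatMap h xs) f) (+-congˡ (∑-concatMap h xs f))

  ∑-zero : ∀ {A : Set} (xs : List A) {f : A → K} → (∀ x → f x ≈ 0#) → ∑ xs f ≈ 0#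
  ∑-zero []       h = refl
  ∑-zero (x ∷ xs) h = trans (+-cong (h x) (∑-zero xs h)) (+-identityˡ 0#)

  ∑-zeroAll : ∀ {A : Set} (xs : List A) {f : A → K} → All (λ x → f x ≈ 0#) xs → ∑ xs f ≈ 0#
  ∑-zeroAll xs hs = trans (∑-congAll hs) (∑-zero xs (λ _ → refl))

  ∑-distribˡ : ∀ {A : Set} (a : K) (xs : List A) (f : A → K) → a *ᴿ ∑ xs f ≈ ∑ xs (λ x → a *ᴿ f x)
  ∑-distribˡ a []       f = zeroʳ a
  ∑-distribˡ a (x ∷ xs) f = trans (distribˡ a _ _) (+-congˡ (∑-distribˡ a xs f))

  ∏-cong : ∀ {A : Set} (xs : List A) {f g : A → K} → (∀ x → f x ≈ g x) → ∏ xs f ≈ ∏ xs g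
  ∏-cong []       h = refl
  ∏-cong (x ∷ xs) h = *-cong (h x) (∏-cong xs h)

  ∏-map : ∀ {A B : Set} (g : A → B) (xs : List A) (f : B → K) → ∏ (map g xs) f ≡ ∏ xs (λ x → f (g x))
  ∏-map g []       f = ≡.refl
  ∏-map g (x ∷ xs) f = ≡.cong (f (g x) *ᴿ_) (∏-map g xs f)

  ∏-swap : ∀ {A : Set} (Q : List A) e f Ps (g : A → K) → ∏ (Q ++ e ∷ f ∷ Ps) g ≈ ∏ (Q ++ f ∷ e ∷ Ps) g
  ∏-swap []      e f Ps g = begin
    g e *ᴿ (g f *ᴿ ∏ Ps g) ≈⟨ sym (*-assoc _ _ _) ⟩
    (g e *ᴿ g f) *ᴿ ∏ Ps g ≈⟨ *-congʳ (*-comm _ _) ⟩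
    (g f *ᴿ g e) *ᴿ ∏ Ps g ≈⟨ *-assoc _ _ _ ⟩
    g f *ᴿ (g e *ᴿ ∏ Ps g) ∎
  ∏-swap (q ∷ Q) e f Ps g = *-congˡ (∏-swap Q e f Ps g)

  ∏-zero : ∀ {A : Set} (Q : List A) e Ps (g : A → K) → g e ≈ 0# → ∏ (Q ++ e ∷ Ps) g ≈ 0#
  ∏-zero []      e Ps g h = trans (*-congʳ h) (zeroˡ _)
  ∏-zero (q ∷ Q) e Ps g h = trans (*-congˡ (∏-zero Q e Ps g h)) (zeroʳ _)

  sgn-+ : ∀ a b → sgn R (a + b) ≈ sgn R a *ᴿ sgn R b
  sgn-+ zero    b = sym (*-identityˡ _)
  sgn-+ (suc a) b = trans (-‿cong (sgn-+ a b)) (-‿distribˡ-* _ _)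

  sgn-square : ∀ a → sgn R a *ᴿ sgn R a ≈ 1#
  sgn-square zero    = *-identityˡ 1#
  sgn-square (suc a) = begin
    - sgn R a *ᴿ - sgn R a     ≈⟨ sym (-‿distribˡ-* _ _) ⟩
    - (sgn R a *ᴿ - sgn R a)   ≈⟨ -‿cong (sym (-‿distribʳ-* _ _)) ⟩
    - (- (sgn R a *ᴿ sgn R a)) ≈⟨ -‿involutive _ ⟩
    sgn R a *ᴿ sgn R a         ≈⟨ sgn-square a ⟩
    1#                         ∎

  sgn-parity : ∀ x o h → x + o ≡ h + h → sgn R x ≈ sgn R o
  sgn-parity x o h e = begin
    sgn R x                           ≈⟨ sym (*-identityʳ _) ⟩
    sgn R x *ᴿ 1#                     ≈⟨ *-congˡ (sym (sgn-square o)) ⟩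
    sgn R x *ᴿ (sgn R o *ᴿ sgn R o)   ≈⟨ sym (*-assoc _ _ _) ⟩
    (sgn R x *ᴿ sgn R o) *ᴿ sgn R o   ≈⟨ *-congʳ (sym (sgn-+ x o)) ⟩
    sgn R (x + o) *ᴿ sgn R o          ≈⟨ *-congʳ (reflexive (≡.cong (sgn R) e)) ⟩
    sgn R (h + h) *ᴿ sgn R o          ≈⟨ *-congʳ (trans (sgn-+ h h) (sgn-square h)) ⟩
    1# *ᴿ sgn R o                     ≈⟨ *-identityˡ _ ⟩
    sgn R o                           ∎

-- Let y, z be two vertices such that a term G(P) of the sum vanishes as soon
-- as P contains an edge at y or z other than {y,z}.  Then only matchings
-- containing {y,z} survive, and the sum over matchings of
-- ws ++ y ∷ as ++ z ∷ bs equals the sum over matchings of ws ++ as ++ bs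
-- with (y , z) prepended (`extract-pair`).

module PairExtraction {c ℓ} (R : CommutativeRing c ℓ) {A : Set} where
  open CommutativeRing R hiding (zero) renaming (Carrier to K; _+_ to _+ᴿ_; _*_ to _*ᴿ_)
  open SetoidReasoning setoid
  open RingSums R

  ∑-choices-++ : ∀ (xs ys : List A) (g : A × List A → K) →
                 ∑ (choices (xs ++ ys)) g ≈
                 ∑ (choices xs) (λ p → g (proj₁ p , proj₂ p ++ ys)) +ᴿ ∑ (choices ys) (λ p → g (proj₁ p , xs ++ proj₂ p))
  ∑-choices-++ []       ys g = sym (+-identityˡ _)
  ∑-choices-++ (x ∷ xs) ys g = begin
    g (x , xs ++ ys) +ᴿ ∑ (map cons (choices (xs ++ ys))) g
      ≈⟨ +-congˡ (reflexive (∑-map cons (choices (xs ++ ys)) g)) ⟩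
    g (x , xs ++ ys) +ᴿ ∑ (choices (xs ++ ys)) (λ p → g (cons p))
      ≈⟨ +-congˡ (∑-choices-++ xs ys (λ p → g (cons p))) ⟩
    g (x , xs ++ ys) +ᴿ (∑ (choices xs) (λ p → g (proj₁ p , x ∷ proj₂ p ++ ys)) +ᴿ ∑ (choices ys) (λ p → g (proj₁ p , x ∷ xs ++ proj₂ p)))
      ≈⟨ sym (+-assoc _ _ _) ⟩
    (g (x , xs ++ ys) +ᴿ ∑ (choices xs) (λ p → g (proj₁ p , x ∷ proj₂ p ++ ys))) +ᴿ ∑ (choices ys) (λ p → g (proj₁ p , x ∷ xs ++ proj₂ p))
      ≈⟨ +-congʳ (+-congˡ (reflexive (≡.sym (∑-map cons (choices xs) (λ p → g (proj₁ p , proj₂ p ++ ys)))))) ⟩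
    (g (x , xs ++ ys) +ᴿ ∑ (map cons (choices xs)) (λ p → g (proj₁ p , proj₂ p ++ ys))) +ᴿ ∑ (choices ys) (λ p → g (proj₁ p , x ∷ xs ++ proj₂ p)) ∎
    where
    cons : A × List A → A × List A
    cons p = proj₁ p , x ∷ proj₂ p

  ∑-choices-∷ : ∀ (x : A) xs (g : A × List A → K) →
                ∑ (choices (x ∷ xs)) g ≈ g (x , xs) +ᴿ ∑ (choices xs) (λ p → g (proj₁ p , x ∷ proj₂ p))
  ∑-choices-∷ x xs g = +-congˡ (reflexive (∑-map _ (choices xs) g))

  withHead : ℕ → (List (A × A) → K) → A → A × List A → K
  withHead n G w p = ∑ (matchings n (proj₂ p)) (λ Ps → G ((w , proj₁ p) ∷ Ps))

  ∑-matchings-head : ∀ n (w : A) xs (G : List (A × A) → K) →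
                     ∑ (matchings (suc (suc n)) (w ∷ xs)) G ≈ ∑ (choices xs) (withHead n G w)
  ∑-matchings-head n w xs G =
    trans (∑-concatMap _ (choices xs) G) (∑-cong (choices xs) (λ p → reflexive (∑-map _ (matchings n (proj₂ p)) G)))

  module _ (y z : A) where

    Touches : A → A → Set
    Touches a b = a ≡ y ⊎ b ≡ y ⊎ a ≡ z ⊎ b ≡ z

    Avoids : A → Set
    Avoids x = x ≢ y × x ≢ z

    VanishesOffPair : (List (A × A) → K) → Set _
    VanishesOffPair G = ∀ Q a b Ps → Touches a b → ¬ (a ≡ y × b ≡ z) → ¬ (a ≡ z × b ≡ y) → G (Q ++ (a , b) ∷ Ps) ≈ 0#

    SwapInvariant : (List (A × A) → K) → Set _
    SwapInvariant G = ∀ Q e f Ps → G (Q ++ e ∷ f ∷ Ps) ≈ G (Q ++ f ∷ e ∷ Ps)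

    -- Expanding along a head w ∉ {y,z}: the partners y and z contribute
    -- nothing, so the partner ranges over ws, as and bs.
    expand-head : (G : List (A × A) → K) → VanishesOffPair G → ∀ n (w : A) ws as bs → Avoids w →
                  ∑ (matchings (suc (suc n)) (w ∷ ws ++ y ∷ as ++ z ∷ bs)) G ≈
                  ∑ (choices ws) (λ p → withHead n G w (proj₁ p , proj₂ p ++ y ∷ as ++ z ∷ bs)) +ᴿ
                  (∑ (choices as) (λ p → withHead n G w (proj₁ p , ws ++ y ∷ proj₂ p ++ z ∷ bs)) +ᴿ
                   ∑ (choices bs) (λ p → withHead n G w (proj₁ p , ws ++ y ∷ as ++ z ∷ proj₂ p)))
    expand-head G vanish n w ws as bs (w≢y , w≢z) = begin
      ∑ (matchings (suc (suc n)) (w ∷ ws ++ y ∷ as ++ z ∷ bs)) G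
        ≈⟨ ∑-matchings-head n w (ws ++ y ∷ as ++ z ∷ bs) G ⟩
      ∑ (choices (ws ++ y ∷ as ++ z ∷ bs)) F
        ≈⟨ ∑-choices-++ ws (y ∷ as ++ z ∷ bs) F ⟩
      Tw +ᴿ ∑ (choices (y ∷ as ++ z ∷ bs)) (λ p → F (proj₁ p , ws ++ proj₂ p))
        ≈⟨ +-congˡ (∑-choices-∷ y (as ++ z ∷ bs) (λ p → F (proj₁ p , ws ++ proj₂ p))) ⟩
      Tw +ᴿ (F (y , ws ++ as ++ z ∷ bs) +ᴿ ∑ (choices (as ++ z ∷ bs)) (λ p → F (proj₁ p , ws ++ y ∷ proj₂ p)))
        ≈⟨ +-congˡ (+-cong partner-y (∑-choices-++ as (z ∷ bs) (λ p → F (proj₁ p , ws ++ y ∷ proj₂ p)))) ⟩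
      Tw +ᴿ (0# +ᴿ (Ta +ᴿ ∑ (choices (z ∷ bs)) (λ p → F (proj₁ p , ws ++ y ∷ as ++ proj₂ p))))
        ≈⟨ +-congˡ (trans (+-identityˡ _) (+-congˡ (∑-choices-∷ z bs (λ p → F (proj₁ p , ws ++ y ∷ as ++ proj₂ p))))) ⟩
      Tw +ᴿ (Ta +ᴿ (F (z , ws ++ y ∷ as ++ bs) +ᴿ Tb))
        ≈⟨ +-congˡ (+-congˡ (trans (+-congʳ partner-z) (+-identityˡ _))) ⟩
      Tw +ᴿ (Ta +ᴿ Tb) ∎
      where
      F = withHead n G w
      Tw = ∑ (choices ws) (λ p → F (proj₁ p , proj₂ p ++ y ∷ as ++ z ∷ bs))
      Ta = ∑ (choices as) (λ p → F (proj₁ p , ws ++ y ∷ proj₂ p ++ z ∷ bs))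
      Tb = ∑ (choices bs) (λ p → F (proj₁ p , ws ++ y ∷ as ++ z ∷ proj₂ p))
      partner-y : F (y , ws ++ as ++ z ∷ bs) ≈ 0#
      partner-y = ∑-zero (matchings n _) (λ Ps → vanish [] w y Ps (inj₂ (inj₁ ≡.refl)) (λ e → w≢y (proj₁ e)) (λ e → w≢z (proj₁ e)))
      partner-z : F (z , ws ++ y ∷ as ++ bs) ≈ 0#
      partner-z = ∑-zero (matchings n _) (λ Ps → vanish [] w z Ps (inj₂ (inj₂ (inj₂ ≡.refl))) (λ e → w≢y (proj₁ e)) (λ e → w≢z (proj₁ e)))

    extract-pair : (G : List (A × A) → K) → VanishesOffPair G → SwapInvariant G → y ≢ z →
                   ∀ n ws as bs → All Avoids ws → All Avoids as → All Avoids bs →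
                   ∑ (matchings (suc (suc n)) (ws ++ y ∷ as ++ z ∷ bs)) G ≈ ∑ (matchings n (ws ++ as ++ bs)) (λ Ps → G ((y , z) ∷ Ps))
    extract-pair G vanish swap y≢z n [] as bs _ avA avB = begin
      ∑ (matchings (suc (suc n)) (y ∷ as ++ z ∷ bs)) G
        ≈⟨ ∑-matchings-head n y (as ++ z ∷ bs) G ⟩
      ∑ (choices (as ++ z ∷ bs)) F
        ≈⟨ ∑-choices-++ as (z ∷ bs) F ⟩
      ∑ (choices as) (λ p → F (proj₁ p , proj₂ p ++ z ∷ bs)) +ᴿ ∑ (choices (z ∷ bs)) (λ p → F (proj₁ p , as ++ proj₂ p))
        ≈⟨ +-cong (∑-zeroAll (choices as) (All.map (λ av → partner≢z (proj₂ (proj₁ av))) (choices-All avA)))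
                  (∑-choices-∷ z bs _) ⟩
      0# +ᴿ (F (z , as ++ bs) +ᴿ ∑ (choices bs) (λ p → F (proj₁ p , as ++ z ∷ proj₂ p)))
        ≈⟨ +-identityˡ _ ⟩
      F (z , as ++ bs) +ᴿ ∑ (choices bs) (λ p → F (proj₁ p , as ++ z ∷ proj₂ p))
        ≈⟨ +-congˡ (∑-zeroAll (choices bs) (All.map (λ av → partner≢z (proj₂ (proj₁ av))) (choices-All avB))) ⟩
      F (z , as ++ bs) +ᴿ 0#
        ≈⟨ +-identityʳ _ ⟩
      ∑ (matchings n (as ++ bs)) (λ Ps → G ((y , z) ∷ Ps)) ∎
      where
      F = withHead n G y
      partner≢z : ∀ {p rs} → p ≢ z → F (p , rs) ≈ 0#
      partner≢z {p} {rs} p≢z =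
        ∑-zero (matchings n rs) (λ Ps → vanish [] y p Ps (inj₁ ≡.refl) (λ e → p≢z (proj₂ e)) (λ e → y≢z (proj₁ e)))
    extract-pair G vanish swap y≢z zero (w ∷ ws) as bs (avw ∷ avW) avA avB =
      trans (expand-head G vanish zero w ws as bs avw)
        (trans (+-cong (∑-zeroAll (choices ws) (All.tabulate (λ {p} _ → empty (proj₂ p) (as ++ z ∷ bs))))
                 (+-cong (∑-zeroAll (choices as) (All.tabulate (λ {p} _ → empty ws (proj₂ p ++ z ∷ bs))))
                         (∑-zeroAll (choices bs) (All.tabulate (λ {p} _ → empty ws (as ++ z ∷ proj₂ p))))))
           (trans (+-identityˡ _) (+-identityˡ _)))
      where
      empty : ∀ us vs {H : List (A × A) → K} → ∑ (matchings 0 (us ++ y ∷ vs)) H ≈ 0#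
      empty us vs = reflexive (≡.cong (λ L → ∑ L _) (matchings-0 us y vs))
    extract-pair G vanish swap y≢z (suc zero) (w ∷ ws) as bs (avw ∷ avW) avA avB =
      trans (expand-head G vanish (suc zero) w ws as bs avw)
        (trans (+-cong (∑-zero (choices ws) (λ _ → refl)) (+-cong (∑-zero (choices as) (λ _ → refl)) (∑-zero (choices bs) (λ _ → refl))))
           (trans (+-identityˡ _) (+-identityˡ _)))
    extract-pair G vanish swap y≢z (suc (suc n)) (w ∷ ws) as bs (avw ∷ avW) avA avB = begin
      ∑ (matchings (suc (suc (suc (suc n)))) (w ∷ ws ++ y ∷ as ++ z ∷ bs)) G
        ≈⟨ expand-head G vanish (suc (suc n)) w ws as bs avw ⟩
      _ ≈⟨ +-cong (∑-congAll (All.map (λ {p} av → IH (proj₁ p) (proj₂ p) as bs (proj₂ av) avA avB) (choices-All avW)))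
                  (+-cong (∑-congAll (All.map (λ {p} av → IH (proj₁ p) ws (proj₂ p) bs avW (proj₂ av) avB) (choices-All avA)))
                          (∑-congAll (All.map (λ {p} av → IH (proj₁ p) ws as (proj₂ p) avW avA (proj₂ av)) (choices-All avB)))) ⟩
      ∑ (choices ws) (λ p → E (proj₁ p , proj₂ p ++ as ++ bs)) +ᴿ
      (∑ (choices as) (λ p → E (proj₁ p , ws ++ proj₂ p ++ bs)) +ᴿ ∑ (choices bs) (λ p → E (proj₁ p , ws ++ as ++ proj₂ p)))
        ≈⟨ +-congˡ (sym (∑-choices-++ as bs (λ p → E (proj₁ p , ws ++ proj₂ p)))) ⟩
      ∑ (choices ws) (λ p → E (proj₁ p , proj₂ p ++ as ++ bs)) +ᴿ ∑ (choices (as ++ bs)) (λ p → E (proj₁ p , ws ++ proj₂ p))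
        ≈⟨ sym (∑-choices-++ ws (as ++ bs) E) ⟩
      ∑ (choices (ws ++ as ++ bs)) E
        ≈⟨ sym (∑-matchings-head n w (ws ++ as ++ bs) (λ Ps → G ((y , z) ∷ Ps))) ⟩
      ∑ (matchings (suc (suc n)) (w ∷ ws ++ as ++ bs)) (λ Ps → G ((y , z) ∷ Ps)) ∎
      where
      E = withHead n (λ Ps → G ((y , z) ∷ Ps)) w
      -- The induction hypothesis for the terms starting with the edge (w , p);
      -- the edge (y , z) is then moved to the front.
      IH : ∀ p ws′ as′ bs′ → All Avoids ws′ → All Avoids as′ → All Avoids bs′ →
           withHead (suc (suc n)) G w (p , ws′ ++ y ∷ as′ ++ z ∷ bs′) ≈ E (p , ws′ ++ as′ ++ bs′)
      IH p ws′ as′ bs′ av₁ av₂ av₃ =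
        trans (extract-pair (λ Ps → G ((w , p) ∷ Ps)) (λ Q → vanish ((w , p) ∷ Q)) (λ Q → swap ((w , p) ∷ Q)) y≢z n ws′ as′ bs′ av₁ av₂ av₃)
              (∑-cong (matchings n _) (λ Ps → swap [] (w , p) (y , z) Ps))

  isolated-vanishes : (u v : A) (G : List (A × A) → K) →
                      (∀ Q x Ps → x ≢ v → G (Q ++ (u , x) ∷ Ps) ≈ 0#) →
                      (∀ Q x Ps → x ≢ v → G (Q ++ (x , u) ∷ Ps) ≈ 0#) →
                      ∀ n ws bs → All (_≢ v) ws → All (_≢ v) bs → ∑ (matchings n (ws ++ u ∷ bs)) G ≈ 0#
  isolated-vanishes u v G left right zero       ws bs _ _ = reflexive (≡.cong (λ L → ∑ L G) (matchings-0 ws u bs))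
  isolated-vanishes u v G left right (suc zero) ws bs _ _ = refl
  isolated-vanishes u v G left right (suc (suc n)) [] bs _ ≢B =
    trans (∑-matchings-head n u bs G)
          (∑-zeroAll (choices bs) (All.map (λ {p} av → ∑-zero (matchings n (proj₂ p)) (λ Ps → left [] (proj₁ p) Ps (proj₁ av))) (choices-All ≢B)))
  isolated-vanishes u v G left right (suc (suc n)) (w ∷ ws) bs (w≢v ∷ ≢W) ≢B = begin
    ∑ (matchings (suc (suc n)) (w ∷ ws ++ u ∷ bs)) G
      ≈⟨ ∑-matchings-head n w (ws ++ u ∷ bs) G ⟩
    ∑ (choices (ws ++ u ∷ bs)) F
      ≈⟨ ∑-choices-++ ws (u ∷ bs) F ⟩
    ∑ (choices ws) (λ p → F (proj₁ p , proj₂ p ++ u ∷ bs)) +ᴿ ∑ (choices (u ∷ bs)) (λ p → F (proj₁ p , ws ++ proj₂ p))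
      ≈⟨ +-cong (∑-zeroAll (choices ws) (All.map (λ {p} av → IH p (proj₂ p) bs (proj₂ av) ≢B) (choices-All ≢W)))
                (∑-choices-∷ u bs (λ p → F (proj₁ p , ws ++ proj₂ p))) ⟩
    0# +ᴿ (F (u , ws ++ bs) +ᴿ ∑ (choices bs) (λ p → F (proj₁ p , ws ++ u ∷ proj₂ p)))
      ≈⟨ +-congˡ (+-cong (∑-zero (matchings n (ws ++ bs)) (λ Ps → right [] w Ps w≢v))
                         (∑-zeroAll (choices bs) (All.map (λ {p} av → IH p ws (proj₂ p) ≢W (proj₂ av)) (choices-All ≢B)))) ⟩
    0# +ᴿ (0# +ᴿ 0#)
      ≈⟨ trans (+-identityˡ _) (+-identityˡ _) ⟩
    0# ∎
    where
    F = withHead n G w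
    IH : ∀ (p : A × List A) ws′ bs′ → All (_≢ v) ws′ → All (_≢ v) bs′ → ∑ (matchings n (ws′ ++ u ∷ bs′)) (λ Ps → G ((w , proj₁ p) ∷ Ps)) ≈ 0#
    IH p = isolated-vanishes u v (λ Ps → G ((w , proj₁ p) ∷ Ps)) (λ Q → left ((w , proj₁ p) ∷ Q)) (λ Q → right ((w , proj₁ p) ∷ Q)) n

module Layout (k m : ℕ) where

  N : ℕ
  N = k + m + k

  input : Fin k → Fin N
  input j = (j ↑ˡ m) ↑ˡ k

  middle : Fin m → Fin N
  middle t = (k ↑ʳ t) ↑ˡ k

  output : Fin k → Fin N
  output t = (k + m) ↑ʳ t

  data View : Fin N → Set where
    viewInput  : ∀ j → View (input j)
    viewMiddle : ∀ t → View (middle t)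
    viewOutput : ∀ t → View (output t)

  view : ∀ i → View i
  view i = ≡.subst View (FinP.join-splitAt (k + m) k i) (outer (splitAt (k + m) i))
    where
    inner : (s : Fin k ⊎ Fin m) → View (join k m s ↑ˡ k)
    inner (inj₁ j) = viewInput j
    inner (inj₂ t) = viewMiddle t
    outer : (s : Fin (k + m) ⊎ Fin k) → View (join (k + m) k s)
    outer (inj₁ i′) = ≡.subst (λ x → View (x ↑ˡ k)) (FinP.join-splitAt k m i′) (inner (splitAt k i′))
    outer (inj₂ t)  = viewOutput t

  inputs middles outputs : List (Fin N)
  inputs  = tabulate input
  middles = tabulate middle
  outputs = tabulate output

  allFin-layout : allFin N ≡ inputs ++ middles ++ outputs
  allFin-layout =
    ≡.trans (tabulate-+ (k + m) k (λ i → i))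
      (≡.trans (≡.cong (_++ outputs) (tabulate-+ k m (λ i → i ↑ˡ k))) (ListP.++-assoc inputs middles outputs))

  filter-layout : (q : Fin N → Bool) → filterᵇ q (allFin N) ≡ filterᵇ q inputs ++ filterᵇ q middles ++ filterᵇ q outputs
  filter-layout q =
    ≡.trans (≡.cong (filterᵇ q) allFin-layout)
      (≡.trans (filterᵇ-++ q inputs _) (≡.cong (filterᵇ q inputs ++_) (filterᵇ-++ q middles outputs)))

  splitAt-input : ∀ j → splitAt (k + m) (input j) ≡ inj₁ (j ↑ˡ m)
  splitAt-input j = FinP.splitAt-↑ˡ (k + m) (j ↑ˡ m) k

  splitAt-middle : ∀ t → splitAt (k + m) (middle t) ≡ inj₁ (k ↑ʳ t)
  splitAt-middle t = FinP.splitAt-↑ˡ (k + m) (k ↑ʳ t) k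

  splitAt-output : ∀ t → splitAt (k + m) (output t) ≡ inj₂ t
  splitAt-output t = FinP.splitAt-↑ʳ (k + m) k t

  isInput-input : ∀ j → isInput {k} {m} (input j) ≡ true
  isInput-input j rewrite splitAt-input j | FinP.splitAt-↑ˡ k j m = ≡.refl

  isInput-middle : ∀ t → isInput {k} {m} (middle t) ≡ false
  isInput-middle t rewrite splitAt-middle t | FinP.splitAt-↑ʳ k m t = ≡.refl

  isInput-output : ∀ t → isInput {k} {m} (output t) ≡ false
  isInput-output t rewrite splitAt-output t = ≡.refl

  onMiddle-input : ∀ Q j → onMiddle {k} {m} Q (input j) ≡ false
  onMiddle-input Q j rewrite splitAt-input j | FinP.splitAt-↑ˡ k j m = ≡.refl

  onMiddle-middle : ∀ Q t → onMiddle {k} {m} Q (middle t) ≡ Q t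
  onMiddle-middle Q t rewrite splitAt-middle t | FinP.splitAt-↑ʳ k m t = ≡.refl

  onMiddle-output : ∀ Q t → onMiddle {k} {m} Q (output t) ≡ false
  onMiddle-output Q t rewrite splitAt-output t = ≡.refl

  inZ-input : ∀ r c j → inZ {k} {m} r c (input j) ≡ lookup r j
  inZ-input r c j rewrite splitAt-input j | FinP.splitAt-↑ˡ k j m = ≡.refl

  inZ-middle : ∀ r c t → inZ {k} {m} r c (middle t) ≡ false
  inZ-middle r c t rewrite splitAt-middle t | FinP.splitAt-↑ʳ k m t = ≡.refl

  inZ-output : ∀ r c t → inZ {k} {m} r c (output t) ≡ lookup c (opposite t)
  inZ-output r c t rewrite splitAt-output t = ≡.refl

  toℕ-input : ∀ j → toℕ (input j) ≡ toℕ j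
  toℕ-input j = ≡.trans (FinP.toℕ-↑ˡ (j ↑ˡ m) k) (FinP.toℕ-↑ˡ j m)

  toℕ-middle : ∀ t → toℕ (middle t) ≡ k + toℕ t
  toℕ-middle t = ≡.trans (FinP.toℕ-↑ˡ (k ↑ʳ t) k) (FinP.toℕ-↑ʳ k t)

  toℕ-output : ∀ t → toℕ (output t) ≡ k + m + toℕ t
  toℕ-output t = FinP.toℕ-↑ʳ (k + m) t

crossesFromLeft : ∀ {n} → Fin n × Fin n → Fin n × Fin n → Bool
crossesFromLeft e f =
  (toℕ (proj₁ e) <ᵇ toℕ (proj₁ f)) ∧ (toℕ (proj₁ f) <ᵇ toℕ (proj₂ e)) ∧ (toℕ (proj₂ e) <ᵇ toℕ (proj₂ f))

crossingNumber : ∀ {n} → List (Fin n × Fin n) → ℕ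
crossingNumber Ps = sumN Ps (λ e → sumN Ps (λ f → ind (crossesFromLeft e f)))

crossings≡crossingNumber : ∀ {n} (Ps : List (Fin n × Fin n)) → crossings Ps ≡ crossingNumber Ps
crossings≡crossingNumber Ps = count-pairs _ Ps Ps

crossingNumber-swap : ∀ {n} (Q : List (Fin n × Fin n)) e f Ps →
                      crossingNumber (Q ++ e ∷ f ∷ Ps) ≡ crossingNumber (Q ++ f ∷ e ∷ Ps)
crossingNumber-swap Q e f Ps =
  ≡.trans (sumN-swap Q e f Ps _) (sumN-cong (Q ++ f ∷ e ∷ Ps) (λ x → sumN-swap Q e f Ps _))

-- The embedding shifts
-- input nodes by 0, middle nodes by 1 (past y) and output nodes by 2 (past
-- y and z), so it preserves the order of nodes, and each node of Γ₁ lies on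
-- a fixed side of y and of z.  The comparisons of a node with y and z are
-- therefore determined by its kind, which we record once and for all.

data Kind : Set where
  inputKind middleKind outputKind : Kind

isInputKind isMiddleKind isOutputKind : Kind → Bool
isInputKind inputKind  = true
isInputKind _          = false
isMiddleKind middleKind = true
isMiddleKind _          = false
isOutputKind outputKind = true
isOutputKind _          = false

shift : Kind → ℕ
shift inputKind  = 0
shift middleKind = 1
shift outputKind = 2

module Embedding {c ℓ} (R : CommutativeRing c ℓ) (k m : ℕ) where
  module Γn = Layout k m
  module Δn = Layout (suc k) m

  embed : Fin (k + m + k) → Fin (suc k + m + suc k)
  embed = embedNode R {k} {m}

  y z : Fin (suc k + m + suc k)
  y = botIn R {k} {m}
  z = botOut R {k} {m}

  embed-input : ∀ j → embed (Γn.input j) ≡ Δn.input (inject₁ j)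
  embed-input j rewrite Γn.splitAt-input j | FinP.splitAt-↑ˡ k j m = ≡.refl

  embed-middle : ∀ t → embed (Γn.middle t) ≡ Δn.middle t
  embed-middle t rewrite Γn.splitAt-middle t | FinP.splitAt-↑ʳ k m t = ≡.refl

  embed-output : ∀ t → embed (Γn.output t) ≡ Δn.output (Fin.suc t)
  embed-output t rewrite Γn.splitAt-output t = ≡.refl

  allFin-Δ : allFin (suc k + m + suc k) ≡ map embed Γn.inputs ++ y ∷ map embed Γn.middles ++ z ∷ map embed Γn.outputs
  allFin-Δ =
    ≡.trans Δn.allFin-layout (≡.trans (≡.cong (λ L → L ++ Δn.middles ++ Δn.outputs) (tabulate-last k Δn.input))
      (≡.trans (ListP.++-assoc (tabulate (λ i → Δn.input (inject₁ i))) (y ∷ []) (Δn.middles ++ Δn.outputs))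
        (≡.cong₂ (λ A B → A ++ y ∷ B) (relabel Γn.input embed-input) (≡.cong₂ (λ A B → A ++ z ∷ B) (relabel Γn.middle embed-middle) (relabel Γn.output embed-output)))))
    where
    relabel : ∀ {n} (f : Fin n → Fin (k + m + k)) {g : Fin n → Fin (suc k + m + suc k)} → (∀ i → embed (f i) ≡ g i) →
              tabulate g ≡ map embed (tabulate f)
    relabel f eq = ≡.sym (≡.trans (ListP.map-tabulate f embed) (ListP.tabulate-cong eq))

  filter-Δ : (qΓ : Fin (k + m + k) → Bool) (qΔ : Fin (suc k + m + suc k) → Bool) → (∀ i → qΔ (embed i) ≡ qΓ i) →
             filterᵇ qΔ (allFin (suc k + m + suc k)) ≡
             map embed (filterᵇ qΓ Γn.inputs) ++
             consIf (qΔ y) y (map embed (filterᵇ qΓ Γn.middles) ++ consIf (qΔ z) z (map embed (filterᵇ qΓ Γn.outputs)))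
  filter-Δ qΓ qΔ h = begin
      filterᵇ qΔ (allFin _)
        ≡⟨ ≡.cong (filterᵇ qΔ) allFin-Δ ⟩
      filterᵇ qΔ (map embed Γn.inputs ++ y ∷ map embed Γn.middles ++ z ∷ map embed Γn.outputs)
        ≡⟨ filterᵇ-++ qΔ (map embed Γn.inputs) _ ⟩
      filterᵇ qΔ (map embed Γn.inputs) ++ filterᵇ qΔ (y ∷ map embed Γn.middles ++ z ∷ map embed Γn.outputs)
        ≡⟨ ≡.cong₂ _++_ (filter-embed Γn.inputs) (≡.trans (filterᵇ-∷ qΔ y _) (≡.cong (consIf (qΔ y) y)
              (≡.trans (filterᵇ-++ qΔ (map embed Γn.middles) _) (≡.cong₂ _++_ (filter-embed Γn.middles)
                 (≡.trans (filterᵇ-∷ qΔ z _) (≡.cong (consIf (qΔ z) z) (filter-embed Γn.outputs))))))) ⟩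
      _ ∎
    where
    open ≡.≡-Reasoning
    filter-embed : ∀ xs → filterᵇ qΔ (map embed xs) ≡ map embed (filterᵇ qΓ xs)
    filter-embed xs = ≡.trans (filterᵇ-map qΔ embed xs) (≡.cong (map embed) (filterᵇ-cong xs h))

  InRange : Kind → ℕ → Set
  InRange inputKind  x = x < k
  InRange middleKind x = k ≤ x × x < k + m
  InRange outputKind x = k + m ≤ x

  Y Z : ℕ
  Y = toℕ y
  Z = toℕ z

  Y≡k : Y ≡ k
  Y≡k = ≡.trans (Δn.toℕ-input (fromℕ k)) (FinP.toℕ-fromℕ k)

  Z≡1+k+m : Z ≡ suc k + m
  Z≡1+k+m = ≡.trans (Δn.toℕ-output Fin.zero) (ℕP.+-identityʳ (suc k + m))

  record NodeFacts (i : Fin (k + m + k)) : Set where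
    constructor facts
    field
      kind      : Kind
      below-y   : (toℕ (embed i) <ᵇ Y) ≡ isInputKind kind
      above-y   : (Y <ᵇ toℕ (embed i)) ≡ not (isInputKind kind)
      below-z   : (toℕ (embed i) <ᵇ Z) ≡ not (isOutputKind kind)
      above-z   : (Z <ᵇ toℕ (embed i)) ≡ isOutputKind kind
      input-Γ   : isInput {k} {m} i ≡ isInputKind kind
      input-Δ   : isInput {suc k} {m} (embed i) ≡ isInputKind kind
      middle-Γ  : onMiddle {k} {m} (λ _ → true) i ≡ isMiddleKind kind
      range     : InRange kind (toℕ i)
      position  : toℕ (embed i) ≡ toℕ i + shift kind

  private
    k<Z : k < suc k + m
    k<Z = s≤s (ℕP.m≤m+n k m)

    rel-true : ∀ {a b a′ b′} → a′ ≡ a → b′ ≡ b → a < b → (a′ <ᵇ b′) ≡ true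
    rel-true ≡.refl ≡.refl = <ᵇ-true

    rel-false : ∀ {a b a′ b′} → a′ ≡ a → b′ ≡ b → b ≤ a → (a′ <ᵇ b′) ≡ false
    rel-false ≡.refl ≡.refl = <ᵇ-false

  nodeFacts : ∀ i → NodeFacts i
  nodeFacts i with Γn.view i
  ... | Γn.viewInput j = facts inputKind
          (rel-true e Y≡k lt) (rel-false Y≡k e (ℕP.<⇒≤ lt))
          (rel-true e Z≡1+k+m (ℕP.<-trans lt k<Z)) (rel-false Z≡1+k+m e (ℕP.<⇒≤ (ℕP.<-trans lt k<Z)))
          (Γn.isInput-input j) (≡.trans (≡.cong (isInput {suc k} {m}) (embed-input j)) (Δn.isInput-input (inject₁ j)))
          (Γn.onMiddle-input _ j) (≡.subst (_< k) (≡.sym (Γn.toℕ-input j)) lt)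
          (≡.trans e (≡.sym (≡.trans (ℕP.+-identityʳ _) (Γn.toℕ-input j))))
    where
    e : toℕ (embed (Γn.input j)) ≡ toℕ j
    e = ≡.trans (≡.cong toℕ (embed-input j)) (≡.trans (Δn.toℕ-input (inject₁ j)) (FinP.toℕ-inject₁ j))
    lt : toℕ j < k
    lt = FinP.toℕ<n j
  ... | Γn.viewMiddle t = facts middleKind
          (rel-false e Y≡k (ℕP.<⇒≤ lt₁)) (rel-true Y≡k e lt₁)
          (rel-true e Z≡1+k+m lt₂) (rel-false Z≡1+k+m e (ℕP.<⇒≤ lt₂))
          (Γn.isInput-middle t) (≡.trans (≡.cong (isInput {suc k} {m}) (embed-middle t)) (Δn.isInput-middle t))
          (Γn.onMiddle-middle _ t)
          (≡.subst (k ≤_) (≡.sym (Γn.toℕ-middle t)) (ℕP.m≤m+n k (toℕ t)) ,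
           ≡.subst (_< k + m) (≡.sym (Γn.toℕ-middle t)) (ℕP.+-monoʳ-< k (FinP.toℕ<n t)))
          (≡.trans e (≡.trans (ℕP.+-comm 1 (k + toℕ t)) (≡.cong (_+ 1) (≡.sym (Γn.toℕ-middle t)))))
    where
    e : toℕ (embed (Γn.middle t)) ≡ suc k + toℕ t
    e = ≡.trans (≡.cong toℕ (embed-middle t)) (Δn.toℕ-middle t)
    lt₁ : k < suc k + toℕ t
    lt₁ = s≤s (ℕP.m≤m+n k (toℕ t))
    lt₂ : suc k + toℕ t < suc k + m
    lt₂ = ℕP.+-monoʳ-< (suc k) (FinP.toℕ<n t)
  ... | Γn.viewOutput t = facts outputKind
          (rel-false e Y≡k (ℕP.<⇒≤ lt₁)) (rel-true Y≡k e lt₁)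
          (rel-false e Z≡1+k+m (ℕP.<⇒≤ lt₂)) (rel-true Z≡1+k+m e lt₂)
          (Γn.isInput-output t) (≡.trans (≡.cong (isInput {suc k} {m}) (embed-output t)) (Δn.isInput-output (Fin.suc t)))
          (Γn.onMiddle-output _ t) (≡.subst (k + m ≤_) (≡.sym (Γn.toℕ-output t)) (ℕP.m≤m+n (k + m) (toℕ t)))
          (≡.trans e (≡.trans (regroup k m (toℕ t)) (≡.cong (_+ 2) (≡.sym (Γn.toℕ-output t)))))
    where
    e : toℕ (embed (Γn.output t)) ≡ suc k + m + suc (toℕ t)
    e = ≡.trans (≡.cong toℕ (embed-output t)) (Δn.toℕ-output (Fin.suc t))
    lt₂ : suc k + m < suc k + m + suc (toℕ t)
    lt₂ = ≡.subst (_< suc k + m + suc (toℕ t)) (ℕP.+-identityʳ (suc k + m)) (ℕP.+-monoʳ-< (suc k + m) (s≤s z≤n))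
    lt₁ : k < suc k + m + suc (toℕ t)
    lt₁ = ℕP.<-trans k<Z lt₂
    regroup : ∀ a b c → suc a + b + suc c ≡ a + b + c + 2
    regroup = solve-∀

  private
    below : ∀ {x y} → x < y → y ≤ x → ⊥
    below x<y y≤x = ℕP.<⇒≱ x<y y≤x

    input<middle : ∀ {x y} → InRange inputKind x → InRange middleKind y → x < y
    input<middle x<k y∈ = ℕP.<-≤-trans x<k (proj₁ y∈)
    input<output : ∀ {x y} → InRange inputKind x → InRange outputKind y → x < y
    input<output x<k k+m≤y = ℕP.<-≤-trans x<k (ℕP.≤-trans (ℕP.m≤m+n k m) k+m≤y)
    middle<output : ∀ {x y} → InRange middleKind x → InRange outputKind y → x < y
    middle<output x∈ k+m≤y = ℕP.<-≤-trans (proj₂ x∈) k+m≤y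

  shift-<ᵇ : ∀ κ λ′ x y → InRange κ x → InRange λ′ y → (x + shift κ <ᵇ y + shift λ′) ≡ (x <ᵇ y)
  shift-<ᵇ inputKind  inputKind  x y _ _ = ≡.sym (<ᵇ-transport {x} {y} {x + 0} {y + 0} (ℕP.+-monoˡ-< 0) (ℕP.+-monoˡ-≤ 0))
  shift-<ᵇ middleKind middleKind x y _ _ = ≡.sym (<ᵇ-transport {x} {y} {x + 1} {y + 1} (ℕP.+-monoˡ-< 1) (ℕP.+-monoˡ-≤ 1))
  shift-<ᵇ outputKind outputKind x y _ _ = ≡.sym (<ᵇ-transport {x} {y} {x + 2} {y + 2} (ℕP.+-monoˡ-< 2) (ℕP.+-monoˡ-≤ 2))
  shift-<ᵇ inputKind  middleKind x y rx ry = ≡.sym (<ᵇ-transport (λ lt → ℕP.+-mono-<-≤ lt z≤n) (λ le → ⊥-elim (below (input<middle rx ry) le)))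
  shift-<ᵇ inputKind  outputKind x y rx ry = ≡.sym (<ᵇ-transport (λ lt → ℕP.+-mono-<-≤ lt z≤n) (λ le → ⊥-elim (below (input<output rx ry) le)))
  shift-<ᵇ middleKind outputKind x y rx ry = ≡.sym (<ᵇ-transport (λ lt → ℕP.+-mono-<-≤ lt (s≤s z≤n)) (λ le → ⊥-elim (below (middle<output rx ry) le)))
  shift-<ᵇ middleKind inputKind  x y rx ry = ≡.sym (<ᵇ-transport (λ lt → ⊥-elim (below (input<middle ry rx) (ℕP.<⇒≤ lt))) (λ le → ℕP.+-mono-≤ le z≤n))
  shift-<ᵇ outputKind inputKind  x y rx ry = ≡.sym (<ᵇ-transport (λ lt → ⊥-elim (below (input<output ry rx) (ℕP.<⇒≤ lt))) (λ le → ℕP.+-mono-≤ le z≤n))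
  shift-<ᵇ outputKind middleKind x y rx ry = ≡.sym (<ᵇ-transport (λ lt → ⊥-elim (below (middle<output ry rx) (ℕP.<⇒≤ lt))) (λ le → ℕP.+-mono-≤ le (s≤s z≤n)))

  embed-<ᵇ : ∀ a b → (toℕ (embed a) <ᵇ toℕ (embed b)) ≡ (toℕ a <ᵇ toℕ b)
  embed-<ᵇ a b with nodeFacts a | nodeFacts b
  ... | facts κa _ _ _ _ _ _ _ ra pa | facts κb _ _ _ _ _ _ _ rb pb
    rewrite pa | pb = shift-<ᵇ κa κb (toℕ a) (toℕ b) ra rb

  y<z : Y < Z
  y<z = ≡.subst₂ _<_ (≡.sym Y≡k) (≡.sym Z≡1+k+m) (s≤s (ℕP.m≤m+n k m))

  y≢z : y ≢ z
  y≢z e = ℕP.<-irrefl (≡.cong toℕ e) y<z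

  embed≢y : ∀ i → embed i ≢ y
  embed≢y i e with nodeFacts i
  ... | facts κ b a _ _ _ _ _ _ _ = contradiction κ b a
    where
    contradiction : ∀ κ → (toℕ (embed i) <ᵇ Y) ≡ isInputKind κ → (Y <ᵇ toℕ (embed i)) ≡ not (isInputKind κ) → ⊥
    contradiction κ b a rewrite e | <ᵇ-irrefl Y with isInputKind κ
    contradiction κ () a | true
    contradiction κ b () | false

  embed≢z : ∀ i → embed i ≢ z
  embed≢z i e with nodeFacts i
  ... | facts κ _ _ b a _ _ _ _ _ = contradiction κ b a
    where
    contradiction : ∀ κ → (toℕ (embed i) <ᵇ Z) ≡ not (isOutputKind κ) → (Z <ᵇ toℕ (embed i)) ≡ isOutputKind κ → ⊥
    contradiction κ b a rewrite e | <ᵇ-irrefl Z with isOutputKind κ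
    contradiction κ () a | false
    contradiction κ b () | true

  crossingNumber-embed : ∀ Ps → crossingNumber (map (mapEdge embed) Ps) ≡ crossingNumber Ps
  crossingNumber-embed Ps =
    ≡.trans (sumN-map (mapEdge embed) Ps _)
      (sumN-cong Ps (λ e → ≡.trans (sumN-map (mapEdge embed) Ps _) (sumN-cong Ps (λ f → ≡.cong ind (crosses-embed e f)))))
    where
    crosses-embed : ∀ e f → crossesFromLeft (mapEdge embed e) (mapEdge embed f) ≡ crossesFromLeft e f
    crosses-embed e f = ≡.cong₂ _∧_ (embed-<ᵇ (proj₁ e) (proj₁ f)) (≡.cong₂ _∧_ (embed-<ᵇ (proj₁ f) (proj₂ e)) (embed-<ᵇ (proj₂ e) (proj₂ f)))

  -- For an edge {a,b} of Γ₁
  -- with a < b, the number of endpoints that are input or output nodes has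
  -- the same parity as (i) the number of crossings of {embed a, embed b}
  -- with the new edge {y,z}, and as (ii) the number of nodes among y, z
  -- lying strictly between embed a and embed b.

  crossesFromLeftℕ : ℕ × ℕ → ℕ × ℕ → Bool
  crossesFromLeftℕ (a , b) (c , d) = (a <ᵇ c) ∧ (c <ᵇ b) ∧ (b <ᵇ d)

  notMiddle : Fin (k + m + k) → ℕ
  notMiddle i = ind (not (onMiddle {k} {m} (λ _ → true) i))

  private
    crossingExpr : (p₁ p₂ p₃ q₁ q₂ q₃ u v : Bool) → ℕ
    crossingExpr p₁ p₂ p₃ q₁ q₂ q₃ u v = (ind (p₁ ∧ p₂ ∧ p₃) + ind (q₁ ∧ q₂ ∧ q₃)) + (ind (not u) + ind (not v))

    crossingExpr-cong : ∀ {p₁ p₂ p₃ q₁ q₂ q₃ u v p₁′ p₂′ p₃′ q₁′ q₂′ q₃′ u′ v′} → p₁ ≡ p₁′ → p₂ ≡ p₂′ → p₃ ≡ p₃′ →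
                        q₁ ≡ q₁′ → q₂ ≡ q₂′ → q₃ ≡ q₃′ → u ≡ u′ → v ≡ v′ →
                        crossingExpr p₁ p₂ p₃ q₁ q₂ q₃ u v ≡ crossingExpr p₁′ p₂′ p₃′ q₁′ q₂′ q₃′ u′ v′
    crossingExpr-cong ≡.refl ≡.refl ≡.refl ≡.refl ≡.refl ≡.refl ≡.refl ≡.refl = ≡.refl

    straddleExpr : (p₁ p₂ q₁ q₂ u v : Bool) → ℕ
    straddleExpr p₁ p₂ q₁ q₂ u v = (ind (p₁ ∧ p₂) + ind (q₁ ∧ q₂)) + (ind (not u) + ind (not v))

    straddleExpr-cong : ∀ {p₁ p₂ q₁ q₂ u v p₁′ p₂′ q₁′ q₂′ u′ v′} → p₁ ≡ p₁′ → p₂ ≡ p₂′ →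
                        q₁ ≡ q₁′ → q₂ ≡ q₂′ → u ≡ u′ → v ≡ v′ → straddleExpr p₁ p₂ q₁ q₂ u v ≡ straddleExpr p₁′ p₂′ q₁′ q₂′ u′ v′
    straddleExpr-cong ≡.refl ≡.refl ≡.refl ≡.refl ≡.refl ≡.refl = ≡.refl

  crossing-parity : ∀ a b → toℕ a < toℕ b →
                    ∃ λ h → (ind (crossesFromLeftℕ (Y , Z) (toℕ (embed a) , toℕ (embed b))) +
                             ind (crossesFromLeftℕ (toℕ (embed a) , toℕ (embed b)) (Y , Z))) + (notMiddle a + notMiddle b) ≡ h + h
  crossing-parity a b a<b with nodeFacts a | nodeFacts b
  ... | facts κa a₁ a₂ a₃ a₄ _ _ a₇ ra _ | facts κb b₁ b₂ b₃ b₄ _ _ b₇ rb _ =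
    let (h , e) = by-kinds κa κb ra rb in h , ≡.trans (crossingExpr-cong a₂ a₃ b₄ a₁ b₂ b₃ a₇ b₇) e
    where
    by-kinds : ∀ κa κb → InRange κa (toℕ a) → InRange κb (toℕ b) →
               ∃ λ h → crossingExpr (not (isInputKind κa)) (not (isOutputKind κa)) (isOutputKind κb)
                                     (isInputKind κa) (not (isInputKind κb)) (not (isOutputKind κb))
                                     (isMiddleKind κa) (isMiddleKind κb) ≡ h + h
    by-kinds inputKind  inputKind  _  _  = 1 , ≡.refl
    by-kinds inputKind  middleKind _  _  = 1 , ≡.refl
    by-kinds inputKind  outputKind _  _  = 1 , ≡.refl
    by-kinds middleKind middleKind _  _  = 0 , ≡.refl
    by-kinds middleKind outputKind _  _  = 1 , ≡.refl
    by-kinds outputKind outputKind _  _  = 1 , ≡.refl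
    by-kinds middleKind inputKind  rx ry = ⊥-elim (below (input<middle ry rx) (ℕP.<⇒≤ a<b))
    by-kinds outputKind inputKind  rx ry = ⊥-elim (below (input<output ry rx) (ℕP.<⇒≤ a<b))
    by-kinds outputKind middleKind rx ry = ⊥-elim (below (middle<output ry rx) (ℕP.<⇒≤ a<b))

  straddle-parity : ∀ a b → toℕ a < toℕ b →
                    ∃ λ h → (ind ((toℕ (embed a) <ᵇ Y) ∧ (Y <ᵇ toℕ (embed b))) +
                             ind ((toℕ (embed a) <ᵇ Z) ∧ (Z <ᵇ toℕ (embed b)))) + (notMiddle a + notMiddle b) ≡ h + h
  straddle-parity a b a<b with nodeFacts a | nodeFacts b
  ... | facts κa a₁ _ a₃ _ _ _ a₇ ra _ | facts κb _ b₂ _ b₄ _ _ b₇ rb _ =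
    let (h , e) = by-kinds κa κb ra rb in h , ≡.trans (straddleExpr-cong a₁ b₂ a₃ b₄ a₇ b₇) e
    where
    by-kinds : ∀ κa κb → InRange κa (toℕ a) → InRange κb (toℕ b) →
               ∃ λ h → straddleExpr (isInputKind κa) (not (isInputKind κb)) (not (isOutputKind κa)) (isOutputKind κb)
                                     (isMiddleKind κa) (isMiddleKind κb) ≡ h + h
    by-kinds inputKind  inputKind  _  _  = 1 , ≡.refl
    by-kinds inputKind  middleKind _  _  = 1 , ≡.refl
    by-kinds inputKind  outputKind _  _  = 2 , ≡.refl
    by-kinds middleKind middleKind _  _  = 0 , ≡.refl
    by-kinds middleKind outputKind _  _  = 1 , ≡.refl
    by-kinds outputKind outputKind _  _  = 1 , ≡.refl
    by-kinds middleKind inputKind  rx ry = ⊥-elim (below (input<middle ry rx) (ℕP.<⇒≤ a<b))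
    by-kinds outputKind inputKind  rx ry = ⊥-elim (below (input<output ry rx) (ℕP.<⇒≤ a<b))
    by-kinds outputKind middleKind rx ry = ⊥-elim (below (middle<output ry rx) (ℕP.<⇒≤ a<b))

  crossingsWithYZ : List (Fin (k + m + k) × Fin (k + m + k)) → ℕ
  crossingsWithYZ Ps = sumN Ps (λ e → ind (crossesFromLeftℕ (Y , Z) (toℕ (embed (proj₁ e)) , toℕ (embed (proj₂ e)))) +
                                      ind (crossesFromLeftℕ (toℕ (embed (proj₁ e)) , toℕ (embed (proj₂ e))) (Y , Z)))

  crossingNumber-yz : ∀ Ps → crossingNumber ((y , z) ∷ map (mapEdge embed) Ps) ≡ crossingsWithYZ Ps + crossingNumber Ps
  crossingNumber-yz Ps =
    ≡.trans (≡.cong₂ _+_ (≡.cong (_+ sumN L (λ f → ind (crossesFromLeft yz f)))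
                                 (≡.cong ind (≡.cong (_∧ ((Y <ᵇ Z) ∧ (Z <ᵇ Z))) (<ᵇ-irrefl Y))))
                         (sumN-+ L _ _))
      (≡.trans (≡.sym (ℕP.+-assoc (sumN L (λ f → ind (crossesFromLeft yz f))) _ _))
        (≡.cong₂ _+_ (≡.trans (≡.sym (sumN-+ L _ _)) (sumN-map (mapEdge embed) Ps _)) (crossingNumber-embed Ps)))
    where
    yz = (y , z)
    L = map (mapEdge embed) Ps

module Terms {c ℓ} (R : CommutativeRing c ℓ) where
  open CommutativeRing R hiding (zero) renaming (Carrier to K; _+_ to _+ᴿ_; _*_ to _*ᴿ_)
  open SetoidReasoning setoid
  open RingSums R

  skewCong : ∀ {n} (w w′ : Fin n → Fin n → K) → (∀ i j → w i j ≈ w′ i j) → ∀ a b → skewAdj R w a b ≈ skewAdj R w′ a b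
  skewCong w w′ h a b with toℕ a <ᵇ toℕ b
  ... | true = h a b
  ... | false with toℕ b <ᵇ toℕ a
  ...   | true  = -‿cong (h b a)
  ...   | false = refl

  χ-cong : ∀ {k} (Θ : Matchgate R k) (w : Fin (k + m Θ + k) → Fin (k + m Θ + k) → K) → (∀ i j → weight Θ i j ≈ w i j) →
           _≈M_ R (χ R Θ) (χ R (record { m = m Θ ; weight = w ; omittable = omittable Θ }))
  χ-cong Θ w h r c =
    ∑-cong (subsetsOfT R Θ) (λ A →
      ∑-cong (perfectMatchings (length (keptNodes R Θ r c A)) (Vec.fromList (keptNodes R Θ r c A))) (λ Ps →
        *-congˡ {μ R Θ r c Ps} (*-congˡ {sgn R (crossings Ps)} (∏-cong Ps (λ e → skewCong (weight Θ) w h (proj₁ e) (proj₂ e))))))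

  module _ {k : ℕ} (Θ : Matchgate R k) (r c : Vec Bool k) where
    private
      n = k + m Θ + k

    overlapsExternal : Fin n → Fin n × Fin n → Bool
    overlapsExternal z e = overlaps (extEdge R Θ z) (suc (toℕ (proj₁ e)) , suc (toℕ (proj₂ e)))

    nodesOfZ : List (Fin n)
    nodesOfZ = filterᵇ (inZ {k} {m Θ} r c) (allFin n)

    overlapCount : List (Fin n × Fin n) → ℕ
    overlapCount Ps = sumN nodesOfZ (λ z → sumN Ps (λ e → ind (overlapsExternal z e)))

    term : List (Fin n × Fin n) → K
    term Ps = μ R Θ r c Ps *ᴿ PfTerm R (skewAdj R (weight Θ)) Ps

    term≈ : ∀ Ps → term Ps ≈ sgn R (overlapCount Ps) *ᴿ (sgn R (crossingNumber Ps) *ᴿ ∏ Ps (λ e → skewAdj R (weight Θ) (proj₁ e) (proj₂ e)))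
    term≈ Ps = reflexive (≡.cong₂ _*ᴿ_ (≡.cong (sgn R) (count-pairs _ nodesOfZ Ps))
                                      (≡.cong (λ x → sgn R x *ᴿ ∏ Ps (λ e → skewAdj R (weight Θ) (proj₁ e) (proj₂ e))) (crossings≡crossingNumber Ps)))

    term-swap : ∀ Q e f Ps → term (Q ++ e ∷ f ∷ Ps) ≈ term (Q ++ f ∷ e ∷ Ps)
    term-swap Q e f Ps = begin
      term (Q ++ e ∷ f ∷ Ps) ≈⟨ term≈ _ ⟩
      _ ≈⟨ *-cong (reflexive (≡.cong (sgn R) (sumN-cong nodesOfZ (λ z → sumN-swap Q e f Ps _))))
                  (*-cong (reflexive (≡.cong (sgn R) (crossingNumber-swap Q e f Ps)))
                          (∏-swap Q e f Ps (λ e → skewAdj R (weight Θ) (proj₁ e) (proj₂ e)))) ⟩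
      _ ≈⟨ sym (term≈ _) ⟩
      term (Q ++ f ∷ e ∷ Ps) ∎

    term-zero : ∀ Q e Ps → skewAdj R (weight Θ) (proj₁ e) (proj₂ e) ≈ 0# → term (Q ++ e ∷ Ps) ≈ 0#
    term-zero Q e Ps h =
      trans (term≈ _) (trans (*-congˡ (trans (*-congˡ (∏-zero Q e Ps (λ e → skewAdj R (weight Θ) (proj₁ e) (proj₂ e)) h)) (zeroʳ _))) (zeroʳ _))

    subsetSum : Vec Bool (m Θ) → K
    subsetSum A = ∑ (perfectMatchings (length (keptNodes R Θ r c A)) (Vec.fromList (keptNodes R Θ r c A))) term

    subsetSum≡ : ∀ A → subsetSum A ≡ ∑ (matchings (length (keptNodes R Θ r c A)) (keptNodes R Θ r c A)) term
    subsetSum≡ A = ≡.cong (λ L → ∑ L term) (perfectMatchings-fromList (keptNodes R Θ r c A))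

eqBits-∷ʳ : ∀ {k} (r c : Vec Bool k) b b′ → eqBits (r ∷ʳ b) (c ∷ʳ b′) ≡ (eqBits r c ∧ eqBool b b′)
eqBits-∷ʳ Vec.[] Vec.[] b b′ with eqBool b b′
... | true  = ≡.refl
... | false = ≡.refl
eqBits-∷ʳ (x Vec.∷ r) (y Vec.∷ c) b b′ with eqBool x y
... | true  = eqBits-∷ʳ r c b b′
... | false = ≡.refl

eqBits⇒≡ : ∀ {k} (r c : Vec Bool k) → eqBits r c ≡ true → r ≡ c
eqBits⇒≡ Vec.[]            Vec.[]            _ = ≡.refl
eqBits⇒≡ (true Vec.∷ r)    (true Vec.∷ c)    e = ≡.cong (true Vec.∷_) (eqBits⇒≡ r c e)
eqBits⇒≡ (false Vec.∷ r)   (false Vec.∷ c)   e = ≡.cong (false Vec.∷_) (eqBits⇒≡ r c e)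
eqBits⇒≡ (true Vec.∷ r)    (false Vec.∷ c)   ()
eqBits⇒≡ (false Vec.∷ r)   (true Vec.∷ c)    ()

-- The sign-twisted block embedding Lift M = [[S M S, 0], [0, S M S]], where
-- S is the diagonal matrix of a sign function s (s r · s r = 1) and the
-- block is selected by the last bit of the row and column index.  Lift is a
-- unital multiplicative embedding of 2^k×2^k matrices into 2^(k+1)×2^(k+1)
-- matrices, and `corner` (the S(·)S-twisted lower right block) undoes it
-- even against an arbitrary factor.

module Lifting {c ℓ} (R : CommutativeRing c ℓ) where
  open CommutativeRing R hiding (zero) renaming (Carrier to K; _+_ to _+ᴿ_; _*_ to _*ᴿ_)
  open SetoidReasoning setoid
  open RingSums R
  open CMSolver *-commutativeMonoid using (solve; _⊜_; _⊕_)

  ⊗ = _⊗_ R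

  interchange : ∀ a b c d → (a +ᴿ b) +ᴿ (c +ᴿ d) ≈ (a +ᴿ c) +ᴿ (b +ᴿ d)
  interchange a b c d = begin
    (a +ᴿ b) +ᴿ (c +ᴿ d) ≈⟨ +-assoc a b _ ⟩
    a +ᴿ (b +ᴿ (c +ᴿ d)) ≈⟨ +-congˡ (sym (+-assoc b c d)) ⟩
    a +ᴿ ((b +ᴿ c) +ᴿ d) ≈⟨ +-congˡ (+-congʳ (+-comm b c)) ⟩
    a +ᴿ ((c +ᴿ b) +ᴿ d) ≈⟨ +-congˡ (+-assoc c b d) ⟩
    a +ᴿ (c +ᴿ (b +ᴿ d)) ≈⟨ sym (+-assoc a c _) ⟩
    (a +ᴿ c) +ᴿ (b +ᴿ d) ∎

  ∑-bits-head : ∀ n (g : Vec Bool (suc n) → K) →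
                ∑ (bits (suc n)) g ≈ ∑ (bits n) (λ s → g (false Vec.∷ s)) +ᴿ ∑ (bits n) (λ s → g (true Vec.∷ s))
  ∑-bits-head n g =
    trans (∑-++ (map (false Vec.∷_) (bits n)) (map (true Vec.∷_) (bits n)) g)
          (+-cong (reflexive (∑-map (false Vec.∷_) (bits n) g)) (reflexive (∑-map (true Vec.∷_) (bits n) g)))

  ∑-bits-last : ∀ k (f : Vec Bool (suc k) → K) →
                ∑ (bits (suc k)) f ≈ ∑ (bits k) (λ s → f (s ∷ʳ false)) +ᴿ ∑ (bits k) (λ s → f (s ∷ʳ true))
  ∑-bits-last zero    f = sym (+-congʳ (+-identityʳ _))
  ∑-bits-last (suc k) f = begin
    ∑ (bits (suc (suc k))) f
      ≈⟨ ∑-bits-head (suc k) f ⟩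
    ∑ (bits (suc k)) (λ s → f (false Vec.∷ s)) +ᴿ ∑ (bits (suc k)) (λ s → f (true Vec.∷ s))
      ≈⟨ +-cong (∑-bits-last k (λ s → f (false Vec.∷ s))) (∑-bits-last k (λ s → f (true Vec.∷ s))) ⟩
    (S false false +ᴿ S false true) +ᴿ (S true false +ᴿ S true true)
      ≈⟨ interchange (S false false) (S false true) (S true false) (S true true) ⟩
    (S false false +ᴿ S true false) +ᴿ (S false true +ᴿ S true true)
      ≈⟨ sym (+-cong (∑-bits-head k (λ s → f (s ∷ʳ false))) (∑-bits-head k (λ s → f (s ∷ʳ true)))) ⟩
    ∑ (bits (suc k)) (λ s → f (s ∷ʳ false)) +ᴿ ∑ (bits (suc k)) (λ s → f (s ∷ʳ true)) ∎
    where
    S : Bool → Bool → K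
    S x y = ∑ (bits k) (λ s → f (x Vec.∷ (s ∷ʳ y)))

  ≈M-∷ʳ : ∀ {k} {A B : Mat R (suc k)} → (∀ r c b b′ → A (r ∷ʳ b) (c ∷ʳ b′) ≈ B (r ∷ʳ b) (c ∷ʳ b′)) → _≈M_ R A B
  ≈M-∷ʳ {A = A} {B} h r′ c′ =
    ≡.subst₂ (λ u v → A u v ≈ B u v) (≡.sym (split r′)) (≡.sym (split c′)) (h (init r′) (init c′) (last r′) (last c′))
    where
    split : ∀ {k} (r : Vec Bool (suc k)) → r ≡ init r ∷ʳ last r
    split r = proj₂ (proj₂ (Vec.initLast r))

  ≈M-sym : ∀ {k} {A B : Mat R k} → _≈M_ R A B → _≈M_ R B A
  ≈M-sym h r c = sym (h r c)

  ≈M-trans : ∀ {k} {A B C : Mat R k} → _≈M_ R A B → _≈M_ R B C → _≈M_ R A C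
  ≈M-trans h g r c = trans (h r c) (g r c)

  ⊗-cong : ∀ {k} {A A′ B B′ : Mat R k} → _≈M_ R A A′ → _≈M_ R B B′ → _≈M_ R (⊗ A B) (⊗ A′ B′)
  ⊗-cong {k} hA hB r c = ∑-cong (bits k) (λ s → *-cong (hA r s) (hB s c))

  idMat-∷ʳ : ∀ {k} (r c : Vec Bool k) b b′ → idMat R (r ∷ʳ b) (c ∷ʳ b′) ≡ (if eqBool b b′ then idMat R r c else 0#)
  idMat-∷ʳ r c b b′ rewrite eqBits-∷ʳ r c b b′ with eqBool b b′ | eqBits r c
  ... | true  | true  = ≡.refl
  ... | true  | false = ≡.refl
  ... | false | true  = ≡.refl
  ... | false | false = ≡.refl

  module _ {k : ℕ} (s : Vec Bool k → K) (s² : ∀ r → s r *ᴿ s r ≈ 1#) where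

    block : Bool → Bool → Mat R k → Vec Bool k → Vec Bool k → K
    block b b′ M r c = if eqBool b b′ then (s r *ᴿ s c) *ᴿ M r c else 0#

    Lift : Mat R k → Mat R (suc k)
    Lift M r′ c′ = block (last r′) (last c′) M (init r′) (init c′)

    Lift-∷ʳ : ∀ M r c b b′ → Lift M (r ∷ʳ b) (c ∷ʳ b′) ≡ block b b′ M r c
    Lift-∷ʳ M r c b b′ rewrite VecP.init-∷ʳ b r | VecP.last-∷ʳ b r | VecP.init-∷ʳ b′ c | VecP.last-∷ʳ b′ c = ≡.refl

    Lift-cong : ∀ {A B} → _≈M_ R A B → _≈M_ R (Lift A) (Lift B)
    Lift-cong {A} {B} h = ≈M-∷ʳ λ r c b b′ → begin
      Lift A (r ∷ʳ b) (c ∷ʳ b′) ≈⟨ reflexive (Lift-∷ʳ A r c b b′) ⟩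
      block b b′ A r c          ≈⟨ block-cong b b′ ⟩
      block b b′ B r c          ≈⟨ reflexive (≡.sym (Lift-∷ʳ B r c b b′)) ⟩
      Lift B (r ∷ʳ b) (c ∷ʳ b′) ∎
      where
      block-cong : ∀ {r c} b b′ → block b b′ A r c ≈ block b b′ B r c
      block-cong {r} {c} true  true  = *-congˡ (h r c)
      block-cong {r} {c} false false = *-congˡ (h r c)
      block-cong true  false = refl
      block-cong false true  = refl

    -- Conjugating by S commutes with products, since S² = 1.
    twist-product : ∀ r x c a b → ((s r *ᴿ s x) *ᴿ a) *ᴿ ((s x *ᴿ s c) *ᴿ b) ≈ (s r *ᴿ s c) *ᴿ (a *ᴿ b)
    twist-product r x c a b = begin
      ((s r *ᴿ s x) *ᴿ a) *ᴿ ((s x *ᴿ s c) *ᴿ b)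
        ≈⟨ solve 5 (λ r x c a b → ((r ⊕ x) ⊕ a) ⊕ ((x ⊕ c) ⊕ b) ⊜ (x ⊕ x) ⊕ ((r ⊕ c) ⊕ (a ⊕ b))) refl (s r) (s x) (s c) a b ⟩
      (s x *ᴿ s x) *ᴿ ((s r *ᴿ s c) *ᴿ (a *ᴿ b))
        ≈⟨ trans (*-congʳ (s² x)) (*-identityˡ _) ⟩
      (s r *ᴿ s c) *ᴿ (a *ᴿ b) ∎

    Lift-⊗ : ∀ A B → _≈M_ R (⊗ (Lift A) (Lift B)) (Lift (⊗ A B))
    Lift-⊗ A B = ≈M-∷ʳ λ r c b b′ → begin
      ⊗ (Lift A) (Lift B) (r ∷ʳ b) (c ∷ʳ b′)
        ≈⟨ ∑-bits-last k _ ⟩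
      ∑ (bits k) (λ x → Lift A (r ∷ʳ b) (x ∷ʳ false) *ᴿ Lift B (x ∷ʳ false) (c ∷ʳ b′)) +ᴿ
      ∑ (bits k) (λ x → Lift A (r ∷ʳ b) (x ∷ʳ true) *ᴿ Lift B (x ∷ʳ true) (c ∷ʳ b′))
        ≈⟨ +-cong (∑-cong (bits k) (λ x → reflexive (≡.cong₂ _*ᴿ_ (Lift-∷ʳ A r x b false) (Lift-∷ʳ B x c false b′))))
                  (∑-cong (bits k) (λ x → reflexive (≡.cong₂ _*ᴿ_ (Lift-∷ʳ A r x b true) (Lift-∷ʳ B x c true b′)))) ⟩
      ∑ (bits k) (λ x → block b false A r x *ᴿ block false b′ B x c) +ᴿ ∑ (bits k) (λ x → block b true A r x *ᴿ block true b′ B x c)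
        ≈⟨ by-blocks b b′ ⟩
      block b b′ (⊗ A B) r c
        ≈⟨ reflexive (≡.sym (Lift-∷ʳ (⊗ A B) r c b b′)) ⟩
      Lift (⊗ A B) (r ∷ʳ b) (c ∷ʳ b′) ∎
      where
      diagonal : ∀ {r c} → ∑ (bits k) (λ x → ((s r *ᴿ s x) *ᴿ A r x) *ᴿ ((s x *ᴿ s c) *ᴿ B x c)) ≈ (s r *ᴿ s c) *ᴿ ⊗ A B r c
      diagonal {r} {c} = trans (∑-cong (bits k) (λ x → twist-product r x c (A r x) (B x c))) (sym (∑-distribˡ _ (bits k) _))
      zeroˡ-∑ : ∀ (f : Vec Bool k → K) → ∑ (bits k) (λ x → 0# *ᴿ f x) ≈ 0#
      zeroˡ-∑ f = ∑-zero (bits k) (λ x → zeroˡ _)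
      zeroʳ-∑ : ∀ (f : Vec Bool k → K) → ∑ (bits k) (λ x → f x *ᴿ 0#) ≈ 0#
      zeroʳ-∑ f = ∑-zero (bits k) (λ x → zeroʳ _)
      by-blocks : ∀ {r c} b b′ → ∑ (bits k) (λ x → block b false A r x *ᴿ block false b′ B x c) +ᴿ
                                 ∑ (bits k) (λ x → block b true A r x *ᴿ block true b′ B x c) ≈ block b b′ (⊗ A B) r c
      by-blocks true  true  = trans (+-cong (zeroˡ-∑ _) diagonal) (+-identityˡ _)
      by-blocks false false = trans (+-cong diagonal (zeroˡ-∑ _)) (+-identityʳ _)
      by-blocks true  false = trans (+-cong (zeroˡ-∑ _) (zeroʳ-∑ _)) (+-identityˡ _)
      by-blocks false true  = trans (+-cong (zeroʳ-∑ _) (zeroˡ-∑ _)) (+-identityˡ _)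

    twist-idMat : ∀ r c → (s r *ᴿ s c) *ᴿ idMat R r c ≈ idMat R r c
    twist-idMat r c with eqBits r c in e
    ... | true rewrite eqBits⇒≡ r c e = trans (*-identityʳ _) (s² c)
    ... | false = zeroʳ _

    Lift-id : _≈M_ R (Lift (idMat R)) (idMat R)
    Lift-id = ≈M-∷ʳ λ r c b b′ →
      trans (reflexive (Lift-∷ʳ (idMat R) r c b b′)) (trans (by-blocks b b′) (reflexive (≡.sym (idMat-∷ʳ r c b b′))))
      where
      by-blocks : ∀ {r c : Vec Bool k} b b′ → block b b′ (idMat R) r c ≈ (if eqBool b b′ then idMat R r c else 0#)
      by-blocks {r} {c} true  true  = twist-idMat r c
      by-blocks {r} {c} false false = twist-idMat r c
      by-blocks true  false = refl
      by-blocks false true  = refl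

    corner : Mat R (suc k) → Mat R k
    corner M r c = (s r *ᴿ s c) *ᴿ M (r ∷ʳ true) (c ∷ʳ true)

    corner-cong : ∀ {A B} → _≈M_ R A B → _≈M_ R (corner A) (corner B)
    corner-cong h r c = *-congˡ (h (r ∷ʳ true) (c ∷ʳ true))

    corner-id : _≈M_ R (corner (idMat R)) (idMat R)
    corner-id r c = trans (*-congˡ (reflexive (idMat-∷ʳ r c true true))) (twist-idMat r c)

    corner-Lift-⊗ : ∀ A B → _≈M_ R (corner (⊗ (Lift A) B)) (⊗ A (corner B))
    corner-Lift-⊗ A B r c = begin
      (s r *ᴿ s c) *ᴿ ⊗ (Lift A) B (r ∷ʳ true) (c ∷ʳ true)
        ≈⟨ *-congˡ (∑-bits-last k _) ⟩
      (s r *ᴿ s c) *ᴿ (∑ (bits k) (λ x → Lift A (r ∷ʳ true) (x ∷ʳ false) *ᴿ B (x ∷ʳ false) (c ∷ʳ true)) +ᴿ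
                       ∑ (bits k) (λ x → Lift A (r ∷ʳ true) (x ∷ʳ true) *ᴿ B (x ∷ʳ true) (c ∷ʳ true)))
        ≈⟨ *-congˡ (trans (+-congʳ (∑-zero (bits k) (λ x → trans (*-congʳ (reflexive (Lift-∷ʳ A r x true false))) (zeroˡ _))))
                          (+-identityˡ _)) ⟩
      (s r *ᴿ s c) *ᴿ ∑ (bits k) (λ x → Lift A (r ∷ʳ true) (x ∷ʳ true) *ᴿ B (x ∷ʳ true) (c ∷ʳ true))
        ≈⟨ ∑-distribˡ _ (bits k) _ ⟩
      ∑ (bits k) (λ x → (s r *ᴿ s c) *ᴿ (Lift A (r ∷ʳ true) (x ∷ʳ true) *ᴿ B (x ∷ʳ true) (c ∷ʳ true)))
        ≈⟨ ∑-cong (bits k) (λ x → trans (*-congˡ (*-congʳ (reflexive (Lift-∷ʳ A r x true true)))) (untwist r x c)) ⟩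
      ∑ (bits k) (λ x → A r x *ᴿ corner B x c) ∎
      where
      untwist : ∀ r x c {a b} → (s r *ᴿ s c) *ᴿ (((s r *ᴿ s x) *ᴿ a) *ᴿ b) ≈ a *ᴿ ((s x *ᴿ s c) *ᴿ b)
      untwist r x c {a} {b} = begin
        (s r *ᴿ s c) *ᴿ (((s r *ᴿ s x) *ᴿ a) *ᴿ b)
          ≈⟨ solve 5 (λ r x c a b → (r ⊕ c) ⊕ (((r ⊕ x) ⊕ a) ⊕ b) ⊜ (r ⊕ r) ⊕ (a ⊕ ((x ⊕ c) ⊕ b))) refl (s r) (s x) (s c) a b ⟩
        (s r *ᴿ s r) *ᴿ (a *ᴿ ((s x *ᴿ s c) *ᴿ b))
          ≈⟨ trans (*-congʳ (s² r)) (*-identityˡ _) ⟩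
        a *ᴿ ((s x *ᴿ s c) *ᴿ b) ∎

    corner-⊗-Lift : ∀ A B → _≈M_ R (corner (⊗ B (Lift A))) (⊗ (corner B) A)
    corner-⊗-Lift A B r c = begin
      (s r *ᴿ s c) *ᴿ ⊗ B (Lift A) (r ∷ʳ true) (c ∷ʳ true)
        ≈⟨ *-congˡ (∑-bits-last k _) ⟩
      (s r *ᴿ s c) *ᴿ (∑ (bits k) (λ x → B (r ∷ʳ true) (x ∷ʳ false) *ᴿ Lift A (x ∷ʳ false) (c ∷ʳ true)) +ᴿ
                       ∑ (bits k) (λ x → B (r ∷ʳ true) (x ∷ʳ true) *ᴿ Lift A (x ∷ʳ true) (c ∷ʳ true)))
        ≈⟨ *-congˡ (trans (+-congʳ (∑-zero (bits k) (λ x → trans (*-congˡ (reflexive (Lift-∷ʳ A x c false true))) (zeroʳ _))))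
                          (+-identityˡ _)) ⟩
      (s r *ᴿ s c) *ᴿ ∑ (bits k) (λ x → B (r ∷ʳ true) (x ∷ʳ true) *ᴿ Lift A (x ∷ʳ true) (c ∷ʳ true))
        ≈⟨ ∑-distribˡ _ (bits k) _ ⟩
      ∑ (bits k) (λ x → (s r *ᴿ s c) *ᴿ (B (r ∷ʳ true) (x ∷ʳ true) *ᴿ Lift A (x ∷ʳ true) (c ∷ʳ true)))
        ≈⟨ ∑-cong (bits k) (λ x → trans (*-congˡ (*-congˡ (reflexive (Lift-∷ʳ A x c true true)))) (untwist r x c)) ⟩
      ∑ (bits k) (λ x → corner B r x *ᴿ A x c) ∎
      where
      untwist : ∀ r x c {a b} → (s r *ᴿ s c) *ᴿ (b *ᴿ ((s x *ᴿ s c) *ᴿ a)) ≈ ((s r *ᴿ s x) *ᴿ b) *ᴿ a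
      untwist r x c {a} {b} = begin
        (s r *ᴿ s c) *ᴿ (b *ᴿ ((s x *ᴿ s c) *ᴿ a))
          ≈⟨ solve 5 (λ r x c a b → (r ⊕ c) ⊕ (b ⊕ ((x ⊕ c) ⊕ a)) ⊜ (c ⊕ c) ⊕ (((r ⊕ x) ⊕ b) ⊕ a)) refl (s r) (s x) (s c) a b ⟩
        (s c *ᴿ s c) *ᴿ (((s r *ᴿ s x) *ᴿ b) *ᴿ a)
          ≈⟨ trans (*-congʳ (s² c)) (*-identityˡ _) ⟩
        ((s r *ᴿ s x) *ᴿ b) *ᴿ a ∎

zeros : ∀ {k} → Vec Bool k → ℕ
zeros {k} r = sumN (allFin k) (λ j → ind (not (lookup r j)))

module _ {c ℓ} (R : CommutativeRing c ℓ) where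
  open CommutativeRing R using (_≈_; _*_; 1#)

  sign : ∀ {k} → Vec Bool k → CommutativeRing.Carrier R
  sign r = sgn R (zeros r)

  sign² : ∀ {k} (r : Vec Bool k) → sign r * sign r ≈ 1#
  sign² r = RingSums.sgn-square R (zeros r)

module Reduction {c ℓ} (R : CommutativeRing c ℓ) (k : ℕ) (Δ : Matchgate R (suc k)) (reducible : Reducible R Δ) where
  open CommutativeRing R hiding (zero) renaming (Carrier to K; _+_ to _+ᴿ_; _*_ to _*ᴿ_)
  open RingProperties ring using (-0#≈0#)
  open RingSums R
  open Terms R
  open Lifting R
  open CMSolver *-commutativeMonoid using (solve; _⊜_; _⊕_) renaming (id to 1ₑ)

  mΔ : ℕ
  mΔ = m Δ

  Γ : Matchgate R k
  Γ = deleteBottom R Δ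

  open Embedding R k mΔ public

  skΔ : Fin (suc k + mΔ + suc k) → Fin (suc k + mΔ + suc k) → K
  skΔ = skewAdj R (weight Δ)

  skΓ : Fin (k + mΔ + k) → Fin (k + mΔ + k) → K
  skΓ = skewAdj R (weight Γ)

  skew-off-pair : ∀ a b → (a ≡ y ⊎ b ≡ y ⊎ a ≡ z ⊎ b ≡ z) → ¬ (a ≡ y × b ≡ z) → ¬ (a ≡ z × b ≡ y) → skΔ a b ≈ 0#
  skew-off-pair a b touches ¬yz ¬zy with toℕ a <ᵇ toℕ b in a<b
  ... | true = proj₂ reducible a b (ℕP.<ᵇ⇒< (toℕ a) (toℕ b) (≡.subst T (≡.sym a<b) tt)) touches ¬yz
  ... | false with toℕ b <ᵇ toℕ a in b<a
  ...   | true  = trans (-‿cong (proj₂ reducible b a (ℕP.<ᵇ⇒< (toℕ b) (toℕ a) (≡.subst T (≡.sym b<a) tt))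
                                                    (flip touches) (λ { (b≡y , a≡z) → ¬zy (a≡z , b≡y) }))) -0#≈0#
    where
    flip : (a ≡ y ⊎ b ≡ y ⊎ a ≡ z ⊎ b ≡ z) → (b ≡ y ⊎ a ≡ y ⊎ b ≡ z ⊎ a ≡ z)
    flip (inj₁ e)                = inj₂ (inj₁ e)
    flip (inj₂ (inj₁ e))         = inj₁ e
    flip (inj₂ (inj₂ (inj₁ e)))  = inj₂ (inj₂ (inj₂ e))
    flip (inj₂ (inj₂ (inj₂ e)))  = inj₂ (inj₂ (inj₁ e))
  ...   | false = refl

  skew-yz : skΔ y z ≈ 1#
  skew-yz rewrite <ᵇ-true y<z = proj₁ reducible

  skew-embed : ∀ a b → skΔ (embed a) (embed b) ≡ skΓ a b
  skew-embed a b rewrite embed-<ᵇ a b | embed-<ᵇ b a = ≡.refl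

  module Γ-Nodes (r c : Vec Bool k) where
    keptΓ? : Vec Bool mΔ → Fin (k + mΔ + k) → Bool
    keptΓ? A i = not (inZ {k} {mΔ} r c i ∨ onMiddle {k} {mΔ} (lookup A) i)

    keptIn keptMid keptOut : Vec Bool mΔ → List (Fin (k + mΔ + k))
    keptIn  A = filterᵇ (keptΓ? A) Γn.inputs
    keptMid A = filterᵇ (keptΓ? A) Γn.middles
    keptOut A = filterᵇ (keptΓ? A) Γn.outputs

    kept-Γ : ∀ A → keptNodes R Γ r c A ≡ keptIn A ++ keptMid A ++ keptOut A
    kept-Γ A = Γn.filter-layout (keptΓ? A)

    zIn zMid zOut : List (Fin (k + mΔ + k))
    zIn  = filterᵇ (inZ {k} {mΔ} r c) Γn.inputs
    zMid = filterᵇ (inZ {k} {mΔ} r c) Γn.middles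
    zOut = filterᵇ (inZ {k} {mΔ} r c) Γn.outputs

    Z-Γ : nodesOfZ Γ r c ≡ zIn ++ zMid ++ zOut
    Z-Γ = Γn.filter-layout (inZ {k} {mΔ} r c)

  -- Rows r ∷ʳ b and columns c ∷ʳ b′ of χ(Δ₁): the set Z of Δ₁ is that of Γ₁
  -- (transported by the embedding) plus y when b holds and z when b′ holds.
  module Index (r c : Vec Bool k) (b b′ : Bool) where
    r′ c′ : Vec Bool (suc k)
    r′ = r ∷ʳ b
    c′ = c ∷ʳ b′

    open Γ-Nodes r c public

    inZ-embed : ∀ i → inZ {suc k} {mΔ} r′ c′ (embed i) ≡ inZ {k} {mΔ} r c i
    inZ-embed i with Γn.view i
    ... | Γn.viewInput j  rewrite embed-input j  | Δn.inZ-input r′ c′ (inject₁ j)  | Γn.inZ-input r c j  = lookup-∷ʳ-inject₁ r b j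
    ... | Γn.viewMiddle t rewrite embed-middle t | Δn.inZ-middle r′ c′ t          | Γn.inZ-middle r c t = ≡.refl
    ... | Γn.viewOutput t rewrite embed-output t | Δn.inZ-output r′ c′ (Fin.suc t) | Γn.inZ-output r c t = lookup-∷ʳ-inject₁ c b′ (opposite t)

    onMiddle-embed : ∀ Q i → onMiddle {suc k} {mΔ} Q (embed i) ≡ onMiddle {k} {mΔ} Q i
    onMiddle-embed Q i with Γn.view i
    ... | Γn.viewInput j  rewrite embed-input j  | Δn.onMiddle-input Q (inject₁ j)  | Γn.onMiddle-input Q j  = ≡.refl
    ... | Γn.viewMiddle t rewrite embed-middle t | Δn.onMiddle-middle Q t          | Γn.onMiddle-middle Q t = ≡.refl
    ... | Γn.viewOutput t rewrite embed-output t | Δn.onMiddle-output Q (Fin.suc t) | Γn.onMiddle-output Q t = ≡.refl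

    inZ-y : inZ {suc k} {mΔ} r′ c′ y ≡ b
    inZ-y = ≡.trans (Δn.inZ-input r′ c′ (fromℕ k)) (lookup-∷ʳ-last r b)

    inZ-z : inZ {suc k} {mΔ} r′ c′ z ≡ b′
    inZ-z = ≡.trans (Δn.inZ-output r′ c′ Fin.zero) (lookup-∷ʳ-last c b′)

    keptΔ? : Vec Bool mΔ → Fin (suc k + mΔ + suc k) → Bool
    keptΔ? A i = not (inZ {suc k} {mΔ} r′ c′ i ∨ onMiddle {suc k} {mΔ} (lookup A) i)

    keptΔ?-y : ∀ A → keptΔ? A y ≡ not b
    keptΔ?-y A = ≡.cong not (≡.trans (≡.cong₂ _∨_ inZ-y (Δn.onMiddle-input (lookup A) (fromℕ k))) (BoolP.∨-identityʳ b))

    keptΔ?-z : ∀ A → keptΔ? A z ≡ not b′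
    keptΔ?-z A = ≡.cong not (≡.trans (≡.cong₂ _∨_ inZ-z (Δn.onMiddle-output (lookup A) Fin.zero)) (BoolP.∨-identityʳ b′))

    kept-Δ : ∀ A → keptNodes R Δ r′ c′ A ≡
                   map embed (keptIn A) ++ consIf (not b) y (map embed (keptMid A) ++ consIf (not b′) z (map embed (keptOut A)))
    kept-Δ A =
      ≡.trans (filter-Δ (keptΓ? A) (keptΔ? A) (λ i → ≡.cong₂ (λ u v → not (u ∨ v)) (inZ-embed i) (onMiddle-embed (lookup A) i)))
              (≡.cong₂ (λ u v → map embed (keptIn A) ++ consIf u y (map embed (keptMid A) ++ consIf v z (map embed (keptOut A))))
                       (keptΔ?-y A) (keptΔ?-z A))

    Z-Δ : nodesOfZ Δ r′ c′ ≡ map embed zIn ++ consIf b y (map embed zMid ++ consIf b′ z (map embed zOut))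
    Z-Δ = ≡.trans (filter-Δ (inZ {k} {mΔ} r c) (inZ {suc k} {mΔ} r′ c′) inZ-embed)
                  (≡.cong₂ (λ u v → map embed zIn ++ consIf u y (map embed zMid ++ consIf v z (map embed zOut))) inZ-y inZ-z)

  extEdge-input : ∀ {k′} (Θ : Matchgate R k′) x → isInput {k′} {m Θ} x ≡ true → extEdge R Θ x ≡ (0 , suc (toℕ x))
  extEdge-input Θ x e rewrite e = ≡.refl

  extEdge-other : ∀ {k′} (Θ : Matchgate R k′) x → isInput {k′} {m Θ} x ≡ false →
                  extEdge R Θ x ≡ (suc (toℕ x) , suc (k′ + m Θ + k′))
  extEdge-other Θ x e rewrite e = ≡.refl

  overlaps-cong : ∀ {a b c d a′ b′ c′ d′} → (a <ᵇ c) ≡ (a′ <ᵇ c′) → (c <ᵇ b) ≡ (c′ <ᵇ b′) → (b <ᵇ d) ≡ (b′ <ᵇ d′) →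
                  (c <ᵇ a) ≡ (c′ <ᵇ a′) → (a <ᵇ d) ≡ (a′ <ᵇ d′) → (d <ᵇ b) ≡ (d′ <ᵇ b′) →
                  overlaps (a , b) (c , d) ≡ overlaps (a′ , b′) (c′ , d′)
  overlaps-cong e₁ e₂ e₃ e₄ e₅ e₆ rewrite e₁ | e₂ | e₃ | e₄ | e₅ | e₆ = ≡.refl

  middle∉Z : ∀ r c x → onMiddle {k} {mΔ} (λ _ → true) x ≡ true → inZ {k} {mΔ} r c x ≡ false
  middle∉Z r c x h with Γn.view x
  ... | Γn.viewInput j  with () ← ≡.trans (≡.sym (Γn.onMiddle-input _ j)) h
  ... | Γn.viewMiddle t = Γn.inZ-middle r c t
  ... | Γn.viewOutput t with () ← ≡.trans (≡.sym (Γn.onMiddle-output _ t)) h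

  module Overlaps (r c : Vec Bool k) (b b′ : Bool) where
    open Index r c b b′ public

    ovΔ = overlapsExternal Δ r′ c′
    ovΓ = overlapsExternal Γ r c

    -- The external edge of an embedded node overlaps an embedded edge iff
    -- this happens in Γ₁ (the embedding preserves order).
    overlaps-embed : ∀ x e → ovΔ (embed x) (mapEdge embed e) ≡ ovΓ x e
    overlaps-embed x e with nodeFacts x
    ... | facts κ _ _ _ _ inΓ inΔ _ _ _ = by-input (isInputKind κ) inΓ inΔ
      where
      ea = proj₁ e
      eb = proj₂ e
      by-input : ∀ β → isInput {k} {mΔ} x ≡ β → isInput {suc k} {mΔ} (embed x) ≡ β → ovΔ (embed x) (mapEdge embed e) ≡ ovΓ x e
      by-input true inΓ inΔ =
        ≡.trans (≡.cong (λ q → overlaps q (suc (toℕ (embed ea)) , suc (toℕ (embed eb)))) (extEdge-input Δ (embed x) inΔ))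
          (≡.trans (overlaps-cong {0} {suc (toℕ (embed x))} {suc (toℕ (embed ea))} {suc (toℕ (embed eb))} {0} {suc (toℕ x)} {suc (toℕ ea)} {suc (toℕ eb)}
                                  ≡.refl (embed-<ᵇ ea x) (embed-<ᵇ x eb) ≡.refl ≡.refl (embed-<ᵇ eb x))
                   (≡.sym (≡.cong (λ q → overlaps q (suc (toℕ ea) , suc (toℕ eb))) (extEdge-input Γ x inΓ))))
      by-input false inΓ inΔ =
        ≡.trans (≡.cong (λ q → overlaps q (suc (toℕ (embed ea)) , suc (toℕ (embed eb)))) (extEdge-other Δ (embed x) inΔ))
          (≡.trans (overlaps-cong {suc (toℕ (embed x))} {suc (suc k + mΔ + suc k)} {suc (toℕ (embed ea))} {suc (toℕ (embed eb))}
                                  {suc (toℕ x)} {suc (k + mΔ + k)} {suc (toℕ ea)} {suc (toℕ eb)}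
                                  (embed-<ᵇ x ea) (≡.trans (toℕ<ᵇn (embed ea)) (≡.sym (toℕ<ᵇn ea)))
                                  (≡.trans (n<ᵇtoℕ (embed eb)) (≡.sym (n<ᵇtoℕ eb)))
                                  (embed-<ᵇ ea x) (embed-<ᵇ x eb) (≡.trans (toℕ<ᵇn (embed eb)) (≡.sym (toℕ<ᵇn eb))))
                   (≡.sym (≡.cong (λ q → overlaps q (suc (toℕ ea) , suc (toℕ eb))) (extEdge-other Γ x inΓ))))

    -- No external edge of a node of Z overlaps the edge (y , z): inputs lie
    -- before y, outputs after z, and middle nodes are never in Z.
    overlaps-yz : ∀ x → inZ {k} {mΔ} r c x ≡ true → ovΔ (embed x) (y , z) ≡ false
    overlaps-yz x x∈Z with nodeFacts x
    ... | facts κ below-y above-y below-z _ _ inΔ middle _ _ = by-kind κ below-y above-y below-z inΔ middle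
      where
      X = toℕ (embed x)
      nΔ = suc k + mΔ + suc k
      by-kind : ∀ κ → (X <ᵇ Y) ≡ isInputKind κ → (Y <ᵇ X) ≡ not (isInputKind κ) → (X <ᵇ Z) ≡ not (isOutputKind κ) →
                isInput {suc k} {mΔ} (embed x) ≡ isInputKind κ → onMiddle {k} {mΔ} (λ _ → true) x ≡ isMiddleKind κ →
                ovΔ (embed x) (y , z) ≡ false
      by-kind inputKind _ Y<X _ inΔ _ rewrite extEdge-input Δ (embed x) inΔ | Y<X = ≡.refl
      by-kind middleKind _ _ _ _ middle with () ← ≡.trans (≡.sym x∈Z) (middle∉Z r c x middle)
      by-kind outputKind X<Y Y<X X<Z inΔ _ rewrite extEdge-other Δ (embed x) inΔ | X<Y | X<Z with Y <ᵇ X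
      ... | true  = ≡.refl
      ... | false = ≡.refl

    straddlesY straddlesZ : Fin (k + mΔ + k) × Fin (k + mΔ + k) → ℕ
    straddlesY e = ind ((toℕ (embed (proj₁ e)) <ᵇ Y) ∧ (Y <ᵇ toℕ (embed (proj₂ e))))
    straddlesZ e = ind ((toℕ (embed (proj₁ e)) <ᵇ Z) ∧ (Z <ᵇ toℕ (embed (proj₂ e))))

    overlaps-y : ∀ e → ind (ovΔ y (mapEdge embed e)) ≡ straddlesY e
    overlaps-y e rewrite extEdge-input Δ y (Δn.isInput-input (fromℕ k)) with (toℕ (embed (proj₁ e)) <ᵇ Y) ∧ (Y <ᵇ toℕ (embed (proj₂ e)))
    ... | true  = ≡.refl
    ... | false = ≡.refl

    overlaps-z : ∀ e → ind (ovΔ z (mapEdge embed e)) ≡ straddlesZ e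
    overlaps-z e =
      ≡.cong ind (≡.trans (≡.cong (λ q → overlaps q (suc A , suc B)) (extEdge-other Δ z (Δn.isInput-output Fin.zero)))
                          (simplify (Z <ᵇ A) (A <ᵇ suc k + mΔ + suc k) (A <ᵇ Z) (Z <ᵇ B) (n<ᵇtoℕ (embed (proj₂ e))) (toℕ<ᵇn (embed (proj₂ e)))))
      where
      A = toℕ (embed (proj₁ e))
      B = toℕ (embed (proj₂ e))
      simplify : ∀ p q s t {u v} → u ≡ false → v ≡ true → ((p ∧ q ∧ u) ∨ (s ∧ t ∧ v)) ≡ (s ∧ t)
      simplify p q s t ≡.refl ≡.refl rewrite BoolP.∧-zeroʳ q | BoolP.∧-zeroʳ p | BoolP.∧-identityʳ t = ≡.refl

    overlapsΓ : List (Fin (k + mΔ + k) × Fin (k + mΔ + k)) → Fin (k + mΔ + k) → ℕ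
    overlapsΓ Ps x = sumN Ps (λ e → ind (ovΓ x e))

    overlaps-embed-sum : ∀ Ps x → sumN (map (mapEdge embed) Ps) (λ e → ind (ovΔ (embed x) e)) ≡ overlapsΓ Ps x
    overlaps-embed-sum Ps x = ≡.trans (sumN-map (mapEdge embed) Ps _) (sumN-cong Ps (λ e → ≡.cong ind (overlaps-embed x e)))

    overlaps-embed-sum² : ∀ Ps X → sumN (map embed X) (λ x → sumN (map (mapEdge embed) Ps) (λ e → ind (ovΔ x e))) ≡ sumN X (overlapsΓ Ps)
    overlaps-embed-sum² Ps X = ≡.trans (sumN-map embed X _) (sumN-cong X (overlaps-embed-sum Ps))

  overlapCount-removed : ∀ r c Ps → let open Overlaps r c true true in
                         overlapCount Δ r′ c′ (map (mapEdge embed) Ps) ≡ overlapCount Γ r c Ps + sumN Ps (λ e → straddlesY e + straddlesZ e)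
  overlapCount-removed r c Ps =
    ≡.trans (≡.cong (λ L → sumN L f) Z-Δ)
    (≡.trans (sumN-++ (map embed zIn) _ f)
    (≡.trans (≡.cong₂ _+_ (overlaps-embed-sum² Ps zIn) (≡.cong₂ _+_ f-y (≡.trans (sumN-++ (map embed zMid) _ f)
               (≡.cong₂ _+_ (overlaps-embed-sum² Ps zMid) (≡.cong₂ _+_ f-z (overlaps-embed-sum² Ps zOut))))))
    (≡.trans (regroup (sumN zIn g) (sumN Ps straddlesY) (sumN zMid g) (sumN Ps straddlesZ) (sumN zOut g))
    (≡.cong₂ _+_ (≡.sym (≡.trans (≡.cong (λ L → sumN L g) Z-Γ) (≡.trans (sumN-++ zIn _ g) (≡.cong (sumN zIn g +_) (sumN-++ zMid zOut g)))))
                 (≡.sym (sumN-+ Ps straddlesY straddlesZ))))))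
    where
    open Overlaps r c true true
    f : Fin (suc k + mΔ + suc k) → ℕ
    f x = sumN (map (mapEdge embed) Ps) (λ e → ind (ovΔ x e))
    g = overlapsΓ Ps
    f-y : f y ≡ sumN Ps straddlesY
    f-y = ≡.trans (sumN-map (mapEdge embed) Ps _) (sumN-cong Ps overlaps-y)
    f-z : f z ≡ sumN Ps straddlesZ
    f-z = ≡.trans (sumN-map (mapEdge embed) Ps _) (sumN-cong Ps overlaps-z)
    regroup : ∀ a p b q c → a + (p + (b + (q + c))) ≡ (a + (b + c)) + (p + q)
    regroup = solve-∀

  overlapCount-kept : ∀ r c Ps → let open Overlaps r c false false in
                      overlapCount Δ r′ c′ ((y , z) ∷ map (mapEdge embed) Ps) ≡ overlapCount Γ r c Ps
  overlapCount-kept r c Ps =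
    ≡.trans (≡.cong (λ L → sumN L f) (≡.trans Z-Δ (≡.trans (≡.cong (map embed zIn ++_) (≡.sym (ListP.map-++ embed zMid zOut)))
                                                           (≡.sym (ListP.map-++ embed zIn (zMid ++ zOut))))))
    (≡.trans (sumN-map embed (zIn ++ zMid ++ zOut) f)
    (≡.trans (≡.cong (λ L → sumN L (λ x → f (embed x))) (≡.sym Z-Γ))
    (sumN-congAll (All.map (λ {x} x∈Z → ≡.cong₂ _+_ (≡.cong ind (overlaps-yz x x∈Z)) (overlaps-embed-sum Ps x))
                           (filterᵇ-sound (inZ {k} {mΔ} r c) (allFin _))))))
    where
    open Overlaps r c false false
    f : Fin (suc k + mΔ + suc k) → ℕ
    f x = sumN ((y , z) ∷ map (mapEdge embed) Ps) (λ e → ind (ovΔ x e))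

  -- Number of input and output nodes of Γ₁ outside Z.
  outsideZ : Vec Bool k → Vec Bool k → ℕ
  outsideZ r c = zeros r + sumN (allFin k) (λ t → ind (not (lookup c (opposite t))))

  notMiddle-kept : ∀ r c A → sumN (keptNodes R Γ r c A) notMiddle ≡ outsideZ r c
  notMiddle-kept r c A = begin
    sumN (keptNodes R Γ r c A) notMiddle
      ≡⟨ ≡.cong (λ L → sumN L notMiddle) (kept-Γ A) ⟩
    sumN (keptIn A ++ keptMid A ++ keptOut A) notMiddle
      ≡⟨ ≡.trans (sumN-++ (keptIn A) _ notMiddle) (≡.cong (sumN (keptIn A) notMiddle +_) (sumN-++ (keptMid A) _ notMiddle)) ⟩
    sumN (keptIn A) notMiddle + (sumN (keptMid A) notMiddle + sumN (keptOut A) notMiddle)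
      ≡⟨ ≡.cong₂ _+_ (kind-sum Γn.input _ on-input)
                     (≡.cong₂ _+_ (≡.trans (kind-sum Γn.middle (λ _ → 0) on-middle) (all-zero (allFin mΔ))) (kind-sum Γn.output _ on-output)) ⟩
    outsideZ r c ∎
    where
    open ≡.≡-Reasoning
    open Γ-Nodes r c
    contribution : Fin (k + mΔ + k) → ℕ
    contribution i = if keptΓ? A i then notMiddle i else 0
    on-input : ∀ j → contribution (Γn.input j) ≡ ind (not (lookup r j))
    on-input j rewrite Γn.inZ-input r c j | Γn.onMiddle-input (lookup A) j | Γn.onMiddle-input (λ _ → true) j
                     | BoolP.∨-identityʳ (lookup r j) with lookup r j
    ... | true  = ≡.refl
    ... | false = ≡.refl
    on-middle : ∀ t → contribution (Γn.middle t) ≡ 0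
    on-middle t rewrite Γn.onMiddle-middle (λ _ → true) t with keptΓ? A (Γn.middle t)
    ... | true  = ≡.refl
    ... | false = ≡.refl
    on-output : ∀ t → contribution (Γn.output t) ≡ ind (not (lookup c (opposite t)))
    on-output t rewrite Γn.inZ-output r c t | Γn.onMiddle-output (lookup A) t | Γn.onMiddle-output (λ _ → true) t
                      | BoolP.∨-identityʳ (lookup c (opposite t)) with lookup c (opposite t)
    ... | true  = ≡.refl
    ... | false = ≡.refl
    kind-sum : ∀ {n} (f : Fin n → Fin (k + mΔ + k)) (g : Fin n → ℕ) → (∀ i → contribution (f i) ≡ g i) →
               sumN (filterᵇ (keptΓ? A) (tabulate f)) notMiddle ≡ sumN (allFin n) g
    kind-sum {n} f g h =
      ≡.trans (sumN-filter (keptΓ? A) (tabulate f) notMiddle)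
        (≡.trans (sumN-tabulate f contribution) (sumN-cong (allFin n) h))
    all-zero : ∀ {B : Set} (xs : List B) → sumN xs (λ _ → 0) ≡ 0
    all-zero []       = ≡.refl
    all-zero (x ∷ xs) = all-zero xs

  kept-sorted : ∀ r c A → AllPairs (λ a b → toℕ a < toℕ b) (keptNodes R Γ r c A)
  kept-sorted r c A = AllPairsP.filter⁺ _ (AllPairsP.tabulate⁺-< (λ i<j → i<j))

  ∏-embed : ∀ Ps → ∏ (map (mapEdge embed) Ps) (λ e → skΔ (proj₁ e) (proj₂ e)) ≈ ∏ Ps (λ e → skΓ (proj₁ e) (proj₂ e))
  ∏-embed Ps = trans (reflexive (∏-map (mapEdge embed) Ps _)) (∏-cong Ps (λ e → reflexive (skew-embed (proj₁ e) (proj₂ e))))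

  -- Ps is a matching of the kept
  -- nodes of Γ₁; the corresponding matching of Δ₁ is its image, together
  -- with the edge (y , z) when y and z are kept.  In both cases the terms
  -- differ by the sign (-1)^outsideZ, by the parity facts of the embedding.
  module PerMatching (r c : Vec Bool k) (A : Vec Bool mΔ) where
    Covers = CoversSorted (λ a b → toℕ a < toℕ b) notMiddle (keptNodes R Γ r c A)

    parity : ∀ Ps → Covers Ps → (F : Fin (k + mΔ + k) × Fin (k + mΔ + k) → ℕ) →
             (∀ a b → toℕ a < toℕ b → ∃ λ h → F (a , b) + (notMiddle a + notMiddle b) ≡ h + h) →
             sgn R (sumN Ps F) ≈ sgn R (outsideZ r c)
    parity Ps (ordered , total) F even with sumN-even (λ e → F e + (notMiddle (proj₁ e) + notMiddle (proj₂ e))) Ps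
                                                      (All.map (λ {e} a<b → even (proj₁ e) (proj₂ e) a<b) ordered)
    ... | H , sum-even =
      sgn-parity (sumN Ps F) (outsideZ r c) H
        (≡.trans (≡.cong (sumN Ps F +_) (≡.sym (≡.trans total (notMiddle-kept r c A))))
                 (≡.trans (≡.sym (sumN-+ Ps F _)) sum-even))

    term-kept : ∀ Ps → Covers Ps → let open Index r c false false in
                term Δ r′ c′ ((y , z) ∷ map (mapEdge embed) Ps) ≈ sgn R (outsideZ r c) *ᴿ term Γ r c Ps
    term-kept Ps covers = begin
      term Δ r′ c′ ((y , z) ∷ map (mapEdge embed) Ps)
        ≈⟨ term≈ Δ r′ c′ _ ⟩
      sgn R (overlapCount Δ r′ c′ ((y , z) ∷ map (mapEdge embed) Ps)) *ᴿ
        (sgn R (crossingNumber ((y , z) ∷ map (mapEdge embed) Ps)) *ᴿ (skΔ y z *ᴿ ∏ (map (mapEdge embed) Ps) (λ e → skΔ (proj₁ e) (proj₂ e))))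
        ≈⟨ *-cong (reflexive (≡.cong (sgn R) (overlapCount-kept r c Ps)))
                  (*-cong (trans (reflexive (≡.cong (sgn R) (crossingNumber-yz Ps))) (sgn-+ (crossingsWithYZ Ps) (crossingNumber Ps)))
                          (*-cong skew-yz (∏-embed Ps))) ⟩
      sgn R (overlapCount Γ r c Ps) *ᴿ ((sgn R (crossingsWithYZ Ps) *ᴿ sgn R (crossingNumber Ps)) *ᴿ (1# *ᴿ ∏Γ))
        ≈⟨ solve 4 (λ a x t p → a ⊕ ((x ⊕ t) ⊕ (1ₑ ⊕ p)) ⊜ x ⊕ (a ⊕ (t ⊕ p))) refl _ _ _ _ ⟩
      sgn R (crossingsWithYZ Ps) *ᴿ (sgn R (overlapCount Γ r c Ps) *ᴿ (sgn R (crossingNumber Ps) *ᴿ ∏Γ))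
        ≈⟨ *-cong (parity Ps covers _ crossing-parity) (sym (term≈ Γ r c Ps)) ⟩
      sgn R (outsideZ r c) *ᴿ term Γ r c Ps ∎
      where
      open SetoidReasoning setoid
      open Index r c false false
      ∏Γ = ∏ Ps (λ e → skΓ (proj₁ e) (proj₂ e))

    term-removed : ∀ Ps → Covers Ps → let open Overlaps r c true true in
                   term Δ r′ c′ (map (mapEdge embed) Ps) ≈ sgn R (outsideZ r c) *ᴿ term Γ r c Ps
    term-removed Ps covers = begin
      term Δ r′ c′ (map (mapEdge embed) Ps)
        ≈⟨ term≈ Δ r′ c′ _ ⟩
      sgn R (overlapCount Δ r′ c′ (map (mapEdge embed) Ps)) *ᴿ
        (sgn R (crossingNumber (map (mapEdge embed) Ps)) *ᴿ ∏ (map (mapEdge embed) Ps) (λ e → skΔ (proj₁ e) (proj₂ e)))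
        ≈⟨ *-cong (trans (reflexive (≡.cong (sgn R) (overlapCount-removed r c Ps))) (sgn-+ (overlapCount Γ r c Ps) straddles))
                  (*-cong (reflexive (≡.cong (sgn R) (crossingNumber-embed Ps))) (∏-embed Ps)) ⟩
      (sgn R (overlapCount Γ r c Ps) *ᴿ sgn R straddles) *ᴿ (sgn R (crossingNumber Ps) *ᴿ ∏ Ps (λ e → skΓ (proj₁ e) (proj₂ e)))
        ≈⟨ solve 3 (λ a x b → (a ⊕ x) ⊕ b ⊜ x ⊕ (a ⊕ b)) refl _ _ _ ⟩
      sgn R straddles *ᴿ (sgn R (overlapCount Γ r c Ps) *ᴿ (sgn R (crossingNumber Ps) *ᴿ ∏ Ps (λ e → skΓ (proj₁ e) (proj₂ e))))
        ≈⟨ *-cong (parity Ps covers _ straddle-parity) (sym (term≈ Γ r c Ps)) ⟩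
      sgn R (outsideZ r c) *ᴿ term Γ r c Ps ∎
      where
      open SetoidReasoning setoid
      open Overlaps r c true true
      straddles = sumN Ps (λ e → straddlesY e + straddlesZ e)

  ∑-matchings-embed : ∀ L (G : List (Fin (suc k + mΔ + suc k) × Fin (suc k + mΔ + suc k)) → K) →
                      ∑ (matchings (length (map embed L)) (map embed L)) G ≡ ∑ (matchings (length L) L) (λ Ps → G (map (mapEdge embed) Ps))
  ∑-matchings-embed L G =
    ≡.trans (≡.cong (λ n → ∑ (matchings n (map embed L)) G) (ListP.length-map embed L))
      (≡.trans (≡.cong (λ Ms → ∑ Ms G) (matchings-map embed (length L) L)) (∑-map (map (mapEdge embed)) (matchings (length L) L) G))

  embedded-avoid : ∀ xs → All (λ x → x ≢ y × x ≢ z) (map embed xs)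
  embedded-avoid xs = AllP.map⁺ (All.universal (λ i → embed≢y i , embed≢z i) xs)

  length-insert₂ : ∀ {A : Set} (ws : List A) y as z bs → length (ws ++ y ∷ as ++ z ∷ bs) ≡ suc (suc (length (ws ++ as ++ bs)))
  length-insert₂ ws y as z bs =
    ≡.trans (ListP.length-++ ws) (≡.trans (≡.cong (length ws +_) (≡.cong suc (ListP.length-++ as)))
      (≡.trans (ℕP.+-suc (length ws) _) (≡.cong suc (≡.trans (≡.cong (length ws +_) (ℕP.+-suc (length as) _))
        (≡.trans (ℕP.+-suc (length ws) _) (≡.cong suc (≡.sym (≡.trans (ListP.length-++ ws) (≡.cong (length ws +_) (ListP.length-++ as))))))))))

  module PerSubset (r c : Vec Bool k) (A : Vec Bool mΔ) where
    open PerMatching r c A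
    open SetoidReasoning setoid

    σ : K
    σ = sgn R (outsideZ r c)

    LΓ : List (Fin (k + mΔ + k))
    LΓ = keptNodes R Γ r c A

    sum-over-Γ : (G : List (Fin (k + mΔ + k) × Fin (k + mΔ + k)) → K) → (∀ Ps → Covers Ps → G Ps ≈ σ *ᴿ term Γ r c Ps) →
                 ∑ (matchings (length LΓ) LΓ) G ≈ σ *ᴿ subsetSum Γ r c A
    sum-over-Γ G h = begin
      ∑ (matchings (length LΓ) LΓ) G
        ≈⟨ ∑-congAll (All.map (λ {Ps} → h Ps) (matchings-cover notMiddle (length LΓ) LΓ (kept-sorted r c A))) ⟩
      ∑ (matchings (length LΓ) LΓ) (λ Ps → σ *ᴿ term Γ r c Ps)
        ≈⟨ sym (∑-distribˡ σ (matchings (length LΓ) LΓ) (term Γ r c)) ⟩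
      σ *ᴿ ∑ (matchings (length LΓ) LΓ) (term Γ r c)
        ≈⟨ *-congˡ (reflexive (≡.sym (subsetSum≡ Γ r c A))) ⟩
      σ *ᴿ subsetSum Γ r c A ∎

    module Kept where
      open Γ-Nodes r c
      ws as bs : List (Fin (suc k + mΔ + suc k))
      ws = map embed (keptIn A)
      as = map embed (keptMid A)
      bs = map embed (keptOut A)

      embedded : ws ++ as ++ bs ≡ map embed LΓ
      embedded = ≡.trans (≡.cong (ws ++_) (≡.sym (ListP.map-++ embed (keptMid A) (keptOut A))))
                   (≡.trans (≡.sym (ListP.map-++ embed (keptIn A) (keptMid A ++ keptOut A))) (≡.cong (map embed) (≡.sym (kept-Γ A))))

    open Kept

    -- y, z ∈ Z: the kept nodes of Δ₁ are exactly the embedded ones.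
    subsetSum-removed : let open Index r c true true in subsetSum Δ r′ c′ A ≈ σ *ᴿ subsetSum Γ r c A
    subsetSum-removed = begin
      subsetSum Δ r′ c′ A
        ≈⟨ reflexive (subsetSum≡ Δ r′ c′ A) ⟩
      ∑ (matchings (length (keptNodes R Δ r′ c′ A)) (keptNodes R Δ r′ c′ A)) (term Δ r′ c′)
        ≈⟨ reflexive (≡.cong (λ L → ∑ (matchings (length L) L) (term Δ r′ c′)) (≡.trans (kept-Δ A) embedded)) ⟩
      ∑ (matchings (length (map embed LΓ)) (map embed LΓ)) (term Δ r′ c′)
        ≈⟨ reflexive (∑-matchings-embed LΓ (term Δ r′ c′)) ⟩
      ∑ (matchings (length LΓ) LΓ) (λ Ps → term Δ r′ c′ (map (mapEdge embed) Ps))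
        ≈⟨ sum-over-Γ _ term-removed ⟩
      σ *ᴿ subsetSum Γ r c A ∎
      where open Index r c true true

    -- y, z ∉ Z: every contributing matching contains the edge (y , z).
    subsetSum-kept : let open Index r c false false in subsetSum Δ r′ c′ A ≈ σ *ᴿ subsetSum Γ r c A
    subsetSum-kept = begin
      subsetSum Δ r′ c′ A
        ≈⟨ reflexive (subsetSum≡ Δ r′ c′ A) ⟩
      ∑ (matchings (length (keptNodes R Δ r′ c′ A)) (keptNodes R Δ r′ c′ A)) G
        ≈⟨ reflexive (≡.cong (λ L → ∑ (matchings (length L) L) G) (kept-Δ A)) ⟩
      ∑ (matchings (length (ws ++ y ∷ as ++ z ∷ bs)) (ws ++ y ∷ as ++ z ∷ bs)) G
        ≈⟨ reflexive (≡.cong (λ n → ∑ (matchings n (ws ++ y ∷ as ++ z ∷ bs)) G) (length-insert₂ ws y as z bs)) ⟩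
      ∑ (matchings (suc (suc (length (ws ++ as ++ bs)))) (ws ++ y ∷ as ++ z ∷ bs)) G
        ≈⟨ PairExtraction.extract-pair R y z G
             (λ Q a b Ps touches ¬yz ¬zy → term-zero Δ r′ c′ Q (a , b) Ps (skew-off-pair a b touches ¬yz ¬zy))
             (term-swap Δ r′ c′) y≢z (length (ws ++ as ++ bs)) ws as bs
             (embedded-avoid _) (embedded-avoid _) (embedded-avoid _) ⟩
      ∑ (matchings (length (ws ++ as ++ bs)) (ws ++ as ++ bs)) (λ Ps → G ((y , z) ∷ Ps))
        ≈⟨ reflexive (≡.cong (λ L → ∑ (matchings (length L) L) (λ Ps → G ((y , z) ∷ Ps))) embedded) ⟩
      ∑ (matchings (length (map embed LΓ)) (map embed LΓ)) (λ Ps → G ((y , z) ∷ Ps))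
        ≈⟨ reflexive (∑-matchings-embed LΓ _) ⟩
      ∑ (matchings (length LΓ) LΓ) (λ Ps → G ((y , z) ∷ map (mapEdge embed) Ps))
        ≈⟨ sum-over-Γ _ term-kept ⟩
      σ *ᴿ subsetSum Γ r c A ∎
      where
      open Index r c false false
      G = term Δ r′ c′

    -- y ∈ Z, z ∉ Z: the kept node z is isolated.
    subsetSum-z-isolated : let open Index r c true false in subsetSum Δ r′ c′ A ≈ 0#
    subsetSum-z-isolated = begin
      subsetSum Δ r′ c′ A
        ≈⟨ reflexive (subsetSum≡ Δ r′ c′ A) ⟩
      ∑ (matchings (length (keptNodes R Δ r′ c′ A)) (keptNodes R Δ r′ c′ A)) G
        ≈⟨ reflexive (≡.cong (λ L → ∑ (matchings (length (keptNodes R Δ r′ c′ A)) L) G) (≡.trans (kept-Δ A) (≡.sym (ListP.++-assoc ws as (z ∷ bs))))) ⟩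
      ∑ (matchings (length (keptNodes R Δ r′ c′ A)) ((ws ++ as) ++ z ∷ bs)) G
        ≈⟨ PairExtraction.isolated-vanishes R z y G
             (λ Q x Ps x≢y → term-zero Δ r′ c′ Q (z , x) Ps
                (skew-off-pair z x (inj₂ (inj₂ (inj₁ ≡.refl))) (λ e → y≢z (≡.sym (proj₁ e))) (λ e → x≢y (proj₂ e))))
             (λ Q x Ps x≢y → term-zero Δ r′ c′ Q (x , z) Ps
                (skew-off-pair x z (inj₂ (inj₂ (inj₂ ≡.refl))) (λ e → x≢y (proj₁ e)) (λ e → y≢z (≡.sym (proj₂ e)))))
             (length (keptNodes R Δ r′ c′ A)) (ws ++ as) bs (AllP.++⁺ (avoid-y (keptIn A)) (avoid-y (keptMid A))) (avoid-y (keptOut A)) ⟩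
      0# ∎
      where
      open Index r c true false
      G = term Δ r′ c′
      avoid-y : ∀ xs → All (_≢ y) (map embed xs)
      avoid-y xs = All.map proj₁ (embedded-avoid xs)

    -- y ∉ Z, z ∈ Z: the kept node y is isolated.
    subsetSum-y-isolated : let open Index r c false true in subsetSum Δ r′ c′ A ≈ 0#
    subsetSum-y-isolated = begin
      subsetSum Δ r′ c′ A
        ≈⟨ reflexive (subsetSum≡ Δ r′ c′ A) ⟩
      ∑ (matchings (length (keptNodes R Δ r′ c′ A)) (keptNodes R Δ r′ c′ A)) G
        ≈⟨ reflexive (≡.cong (λ L → ∑ (matchings (length (keptNodes R Δ r′ c′ A)) L) G) (kept-Δ A)) ⟩
      ∑ (matchings (length (keptNodes R Δ r′ c′ A)) (ws ++ y ∷ as ++ bs)) G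
        ≈⟨ PairExtraction.isolated-vanishes R y z G
             (λ Q x Ps x≢z → term-zero Δ r′ c′ Q (y , x) Ps
                (skew-off-pair y x (inj₁ ≡.refl) (λ e → x≢z (proj₂ e)) (λ e → y≢z (proj₁ e))))
             (λ Q x Ps x≢z → term-zero Δ r′ c′ Q (x , y) Ps
                (skew-off-pair x y (inj₂ (inj₁ ≡.refl)) (λ e → y≢z (proj₂ e)) (λ e → x≢z (proj₁ e))))
             (length (keptNodes R Δ r′ c′ A)) ws (as ++ bs) (avoid-z (keptIn A)) (AllP.++⁺ (avoid-z (keptMid A)) (avoid-z (keptOut A))) ⟩
      0# ∎
      where
      open Index r c false true
      G = term Δ r′ c′
      avoid-z : ∀ xs → All (_≢ z) (map embed xs)
      avoid-z xs = All.map proj₂ (embedded-avoid xs)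

  sign-outsideZ : ∀ r c → sgn R (outsideZ r c) ≈ sign R r *ᴿ sign R c
  sign-outsideZ r c =
    trans (sgn-+ (zeros r) _) (*-congˡ (reflexive (≡.cong (sgn R) (sumN-opposite k (λ j → ind (not (lookup c j)))))))

  reduction : _≈M_ R (χ R Δ) (Lift (sign R) (sign² R) (χ R Γ))
  reduction = ≈M-∷ʳ λ r c b b′ → trans (by-blocks r c b b′) (reflexive (≡.sym (Lift-∷ʳ (sign R) (sign² R) (χ R Γ) r c b b′)))
    where
    sum-subsets : ∀ r c b b′ → (∀ A → subsetSum Δ (r ∷ʳ b) (c ∷ʳ b′) A ≈ sgn R (outsideZ r c) *ᴿ subsetSum Γ r c A) →
                  χ R Δ (r ∷ʳ b) (c ∷ʳ b′) ≈ (sign R r *ᴿ sign R c) *ᴿ χ R Γ r c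
    sum-subsets r c b b′ h =
      trans (∑-cong (subsetsOfT R Γ) h) (trans (sym (∑-distribˡ _ (subsetsOfT R Γ) _)) (*-congʳ (sign-outsideZ r c)))
    by-blocks : ∀ r c b b′ → χ R Δ (r ∷ʳ b) (c ∷ʳ b′) ≈ block (sign R) (sign² R) b b′ (χ R Γ) r c
    by-blocks r c true  true  = sum-subsets r c true true (λ A → PerSubset.subsetSum-removed r c A)
    by-blocks r c false false = sum-subsets r c false false (λ A → PerSubset.subsetSum-kept r c A)
    by-blocks r c true  false = trans (∑-cong (subsetsOfT R Γ) (λ A → PerSubset.subsetSum-z-isolated r c A)) (∑-zero (subsetsOfT R Γ) (λ _ → refl))
    by-blocks r c false true  = trans (∑-cong (subsetsOfT R Γ) (λ A → PerSubset.subsetSum-y-isolated r c A)) (∑-zero (subsetsOfT R Γ) (λ _ → refl))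

-- Every k-bit matchgate Γ′ arises as Γ₁ for a reducible (k+1)-bit
-- matchgate Δ′: insert y and z, join them by an edge of weight 1 and keep
-- the weights of Γ′ between embedded nodes.  We describe the weight of Δ′
-- through the partial inverse of the embedding.

uninject₁ : ∀ {n} → Fin (suc n) → Maybe (Fin n)
uninject₁ {zero}  Fin.zero    = nothing
uninject₁ {suc n} Fin.zero    = just Fin.zero
uninject₁ {suc n} (Fin.suc j) = Maybe.map Fin.suc (uninject₁ j)

uninject₁-inject₁ : ∀ {n} (j : Fin n) → uninject₁ (inject₁ j) ≡ just j
uninject₁-inject₁ {suc n} Fin.zero    = ≡.refl
uninject₁-inject₁ {suc n} (Fin.suc j) rewrite uninject₁-inject₁ j = ≡.refl

uninject₁-fromℕ : ∀ n → uninject₁ (fromℕ n) ≡ nothing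
uninject₁-fromℕ zero    = ≡.refl
uninject₁-fromℕ (suc n) rewrite uninject₁-fromℕ n = ≡.refl

module Extension {c ℓ} (R : CommutativeRing c ℓ) (k : ℕ) (Γ′ : Matchgate R k) where
  open CommutativeRing R hiding (zero) renaming (Carrier to K; _+_ to _+ᴿ_; _*_ to _*ᴿ_)

  open Embedding R k (m Γ′)

  unembed : Fin (suc k + m Γ′ + suc k) → Maybe (Fin (k + m Γ′ + k))
  unembed i with splitAt (suc k + m Γ′) i
  ... | inj₂ Fin.zero    = nothing
  ... | inj₂ (Fin.suc t) = just (Γn.output t)
  ... | inj₁ i′ with splitAt (suc k) i′
  ...   | inj₁ j = Maybe.map Γn.input (uninject₁ j)
  ...   | inj₂ t = just (Γn.middle t)

  unembed-embed : ∀ i → unembed (embed i) ≡ just i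
  unembed-embed i with Γn.view i
  ... | Γn.viewInput j  rewrite embed-input j  | Δn.splitAt-input (inject₁ j) | FinP.splitAt-↑ˡ (suc k) (inject₁ j) (m Γ′)
                              | uninject₁-inject₁ j = ≡.refl
  ... | Γn.viewMiddle t rewrite embed-middle t | Δn.splitAt-middle t | FinP.splitAt-↑ʳ (suc k) (m Γ′) t = ≡.refl
  ... | Γn.viewOutput t rewrite embed-output t | Δn.splitAt-output (Fin.suc t) = ≡.refl

  unembed-y : unembed y ≡ nothing
  unembed-y rewrite Δn.splitAt-input (fromℕ k) | FinP.splitAt-↑ˡ (suc k) (fromℕ k) (m Γ′) | uninject₁-fromℕ k = ≡.refl

  unembed-z : unembed z ≡ nothing
  unembed-z rewrite Δn.splitAt-output Fin.zero = ≡.refl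

  weight′ : Maybe (Fin (k + m Γ′ + k)) → Maybe (Fin (k + m Γ′ + k)) → K
  weight′ (just a) (just b) = weight Γ′ a b
  weight′ _        _        = 0#

  weight′-nothingˡ : ∀ {u} v → u ≡ nothing → weight′ u v ≈ 0#
  weight′-nothingˡ v ≡.refl = refl

  weight′-nothingʳ : ∀ u {v} → v ≡ nothing → weight′ u v ≈ 0#
  weight′-nothingʳ (just a) ≡.refl = refl
  weight′-nothingʳ nothing  ≡.refl = refl

  isYZ : Fin (suc k + m Γ′ + suc k) → Fin (suc k + m Γ′ + suc k) → Bool
  isYZ i j = does (i FinP.≟ y) ∧ does (j FinP.≟ z)

  isYZ-false : ∀ i j → ¬ (i ≡ y × j ≡ z) → isYZ i j ≡ false
  isYZ-false i j ¬yz with i FinP.≟ y | j FinP.≟ z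
  ... | yes i≡y | yes j≡z = ⊥-elim (¬yz (i≡y , j≡z))
  ... | yes _   | no _    = ≡.refl
  ... | no _    | _       = ≡.refl

  Δ′ : Matchgate R (suc k)
  Δ′ = record
    { m         = m Γ′
    ; weight    = λ i j → if isYZ i j then 1# else weight′ (unembed i) (unembed j)
    ; omittable = omittable Γ′
    }

  Δ′-reducible : Reducible R Δ′
  Δ′-reducible = yz-weight , off-pair
    where
    yz-weight : weight Δ′ y z ≈ 1#
    yz-weight rewrite dec-true (y FinP.≟ y) ≡.refl | dec-true (z FinP.≟ z) ≡.refl = refl
    off-pair : ∀ i j → toℕ i < toℕ j → (i ≡ y ⊎ j ≡ y ⊎ i ≡ z ⊎ j ≡ z) → ¬ (i ≡ y × j ≡ z) → weight Δ′ i j ≈ 0#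
    off-pair i j _ touches ¬yz rewrite isYZ-false i j ¬yz with touches
    ... | inj₁ ≡.refl                = weight′-nothingˡ (unembed j) unembed-y
    ... | inj₂ (inj₁ ≡.refl)         = weight′-nothingʳ (unembed i) unembed-y
    ... | inj₂ (inj₂ (inj₁ ≡.refl))  = weight′-nothingˡ (unembed j) unembed-z
    ... | inj₂ (inj₂ (inj₂ ≡.refl))  = weight′-nothingʳ (unembed i) unembed-z

  deleteBottom-Δ′ : ∀ i j → weight (deleteBottom R Δ′) i j ≈ weight Γ′ i j
  deleteBottom-Δ′ i j rewrite isYZ-false (embed i) (embed j) (λ yz → embed≢y i (proj₁ yz)) | unembed-embed i | unembed-embed j = refl

module _ {c ℓ} (R : CommutativeRing c ℓ) (k : ℕ) (Δ₁ : Matchgate R (suc k)) (reducible : Reducible R Δ₁) where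
  open CommutativeRing R using (Carrier; _≈_; _*_; 1#; refl)
  open Lifting R
  open Reduction R k Δ₁ reducible using (reduction)

  private
    Γ₁ : Matchgate R k
    Γ₁ = deleteBottom R Δ₁

    s : Vec Bool k → Carrier
    s = sign R

    s² : ∀ r → s r * s r ≈ 1#
    s² = sign² R

    ≈M-refl : ∀ {n} {A : Mat R n} → _≈M_ R A A
    ≈M-refl _ _ = refl

  -- (i) The twisted corner of an inverse of χ(Δ₁) inverts χ(Γ₁).
  reduct-nonsingular : Nonsingular R (charMat R Δ₁) → Nonsingular R (charMat R Γ₁)
  reduct-nonsingular (B , χB≈I , Bχ≈I) = corner s s² B , right-inverse , left-inverse
    where
    right-inverse : _≈M_ R (⊗ (χ R Γ₁) (corner s s² B)) (idMat R)
    right-inverse =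
      ≈M-trans (≈M-sym (corner-Lift-⊗ s s² (χ R Γ₁) B))
        (≈M-trans (corner-cong s s² (≈M-trans (⊗-cong (≈M-sym reduction) ≈M-refl) χB≈I))
                  (corner-id s s²))
    left-inverse : _≈M_ R (⊗ (corner s s² B) (χ R Γ₁)) (idMat R)
    left-inverse =
      ≈M-trans (≈M-sym (corner-⊗-Lift s s² (χ R Γ₁) B))
        (≈M-trans (corner-cong s s² (≈M-trans (⊗-cong ≈M-refl (≈M-sym reduction)) Bχ≈I))
                  (corner-id s s²))

  -- (ii) If χ(Γ₁)⁻¹ = χ(Γ′), then χ(Δ₁)⁻¹ = χ(Δ′) for Γ′ with an isolated
  -- edge added, since both are lifts and Lift is multiplicative and unital.
  inverse-character : (∃ λ N → IsInverse R (charMat R Γ₁) N × IsCharacterMatrix R N) →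
                      (∃ λ N → IsInverse R (charMat R Δ₁) N × IsCharacterMatrix R N)
  inverse-character (N , (χN≈I , Nχ≈I) , (Γ′ , χΓ′≈N)) = χ R Δ′ , (right-inverse , left-inverse) , (Δ′ , λ _ _ → refl)
    where
    open Extension R k Γ′ using (Δ′; Δ′-reducible; deleteBottom-Δ′)
    χΔ′≈LiftN : _≈M_ R (χ R Δ′) (Lift s s² N)
    χΔ′≈LiftN =
      ≈M-trans (Reduction.reduction R k Δ′ Δ′-reducible)
               (Lift-cong s s² (≈M-trans (Terms.χ-cong R (deleteBottom R Δ′) (weight Γ′) deleteBottom-Δ′) χΓ′≈N))
    right-inverse : _≈M_ R (⊗ (χ R Δ₁) (χ R Δ′)) (idMat R)
    right-inverse =
      ≈M-trans (⊗-cong reduction χΔ′≈LiftN)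
        (≈M-trans (Lift-⊗ s s² (χ R Γ₁) N)
          (≈M-trans (Lift-cong s s² χN≈I) (Lift-id s s²)))
    left-inverse : _≈M_ R (⊗ (χ R Δ′) (χ R Δ₁)) (idMat R)
    left-inverse =
      ≈M-trans (⊗-cong χΔ′≈LiftN reduction)
        (≈M-trans (Lift-⊗ s s² N (χ R Γ₁))
          (≈M-trans (Lift-cong s s² Nχ≈I) (Lift-id s s²)))

lemma4p1 : ∀ {c ℓ} (R : CommutativeRing c ℓ) (k : ℕ) (Δ₁ : Matchgate R (suc k)) →
    Reducible R Δ₁ →
    (Nonsingular R (charMat R Δ₁) → Nonsingular R (charMat R (deleteBottom R Δ₁))) ×
    ((∃ λ N → IsInverse R (charMat R (deleteBottom R Δ₁)) N × IsCharacterMatrix R N) →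
     (∃ λ N → IsInverse R (charMat R Δ₁) N × IsCharacterMatrix R N))
lemma4p1 R k Δ₁ reducible = reduct-nonsingular R k Δ₁ reducible , inverse-character R k Δ₁ reducible
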